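{- Let $p=[\sigma_1,\ldots,\sigma_m]$ be a disjoint chains partially ordered pattern, and for each $i$ let $A_i(x)$ be the exponential generating function for the number of permutations avoiding the chain pattern $\mathrm{red}(\sigma_i)$ (the POP consisting of the single chain read top to bottom as $\mathrm{red}(\sigma_i)$). Then the exponential generating function $A(x)$ for the number of permutations avoiding $p$ is $$A(x)=\sum_{i=1}^{m}A_i(x)\prod_{j=1}^{i-1}\bigl((x-1)A_j(x)+1\bigr).$$
   Context: A partially ordered pattern (POP) of length $k$ is a poset on $[k]$; an occurrence of it in a permutation $\pi=\pi_1\cdots\pi_n$ is a subsequence $\pi_{i_1}\cdots\pi_{i_k}$ with $i_1<\cdots<i_k$ such that $\pi_{i_j}<\pi_{i_m}$ whenever $j<m$ in the poset; avoidance means having no occurrence. For a sequence $s$ of distinct numbers, $\mathrm{red}(s)$ replaces the $i$-th smallest entry by $i$. A disjoint chains POP $[\sigma_1,\ldots,\sigma_m]$ of length $k=\sum_i k_i$ is the POP whose poset is a disjoint union of $m$ chains, where $\sigma_i$ is a permutation (a sequence) of the set $\{1+\sum_{j<i}k_j,\ldots,\sum_{j\le i}k_j\}$ (so $\mathrm{red}(\sigma_i)$ is a permutation of $[k_i]$) and the $i$-th chain, read from top to bottom, is $\sigma_i$ (the first entry of $\sigma_i$ is the largest element of the chain); elements of different chains are incomparable. The exponential generating function of $c(n)$ is $\sum_{n\ge0}c(n)x^n/n!$. -}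

module Defs where

open import Data.Nat as ℕ using (ℕ; zero; suc; _∸_; _≤_)
open import Data.Nat.Combinatorics using (_C_)
open import Data.Integer as ℤ using (ℤ; +_; 0ℤ; 1ℤ)
open import Data.Fin as Fin using (Fin; toℕ; inject)
open import Data.Vec using (Vec; lookup)
open import Data.List using (List; []; _∷_; _++_; [_]; map; length; upTo)
open import Data.List.Membership.Propositional using (_∈_)
open import Data.List.Relation.Binary.Permutation.Propositional using (_↭_)
open import Data.Product using (Σ; _×_; ∃-syntax)
open import Data.Refinement using (Refinement-syntax)
open import Function.Bundles using (_↔_)
open import Relation.Binary.PropositionalEquality using (_≡_)
open import Relation.Nullary using (¬_)

-- A permutation of [n], written in one-line notation; the value i : Fin n
-- stands for i+1 (only relative order matters).
IsPermutation : {n : ℕ} → Vec (Fin n) n → Set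
IsPermutation {n} π = ∀ (i j : Fin n) → lookup π i ≡ lookup π j → i ≡ j

-- A POP of length k: a strict partial order on [k], given as a relation
-- R a b meaning "a < b in the poset"; element a : Fin k stands for a+1.
POP : ℕ → Set₁
POP k = Fin k → Fin k → Set

Occurs : {k n : ℕ} → POP k → Vec (Fin n) n → Set
Occurs {k} {n} R π =
  Σ (Fin k → Fin n) λ ι →
    (∀ a b → a Fin.< b → ι a Fin.< ι b) ×
    (∀ a b → R a b → lookup π (ι a) Fin.< lookup π (ι b))

Avoids : {k n : ℕ} → POP k → Vec (Fin n) n → Set
Avoids R π = ¬ Occurs R π

AvoidersOf : {k : ℕ} → POP k → ℕ → Set
AvoidersOf R n = [ π ∈ Vec (Fin n) n ∣ IsPermutation π × Avoids R π ]

Counts : {k : ℕ} → POP k → (ℕ → ℕ) → Set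
Counts R c = ∀ n → Fin (c n) ↔ AvoidersOf R n

-- The POP on [k] whose poset is the disjoint union of the chains in cs;
-- each chain is a list of elements of [k] (1-based), read from top to
-- bottom: an element appearing earlier in a chain is larger.
ChainsPOP : (k : ℕ) → List (List ℕ) → POP k
ChainsPOP k cs a b =
  Σ (List ℕ) λ c → (c ∈ cs) ×
    ∃[ xs ] ∃[ ys ] ∃[ zs ] (c ≡ xs ++ [ suc (toℕ b) ] ++ ys ++ [ suc (toℕ a) ] ++ zs)

IsChainPerm : List ℕ → Set
IsChainPerm τ = (1 ≤ length τ) × (τ ↭ map suc (upTo (length τ)))

ChainPattern : (τ : List ℕ) → POP (length τ)
ChainPattern τ = ChainsPOP (length τ) [ τ ]

-- Given red(σ_1),…,red(σ_m), the chains σ_1,…,σ_m: σ_i is red(σ_i)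
-- shifted by k_1+…+k_{i-1}.
totalLen : (m : ℕ) → (Fin m → List ℕ) → ℕ
totalLen zero τ = 0
totalLen (suc m) τ = length (τ Fin.zero) ℕ.+ totalLen m (λ i → τ (Fin.suc i))

chainsOf : (m : ℕ) → (Fin m → List ℕ) → List (List ℕ)
chainsOf zero τ = []
chainsOf (suc m) τ =
  τ Fin.zero ∷ map (map (length (τ Fin.zero) ℕ.+_)) (chainsOf m (λ i → τ (Fin.suc i)))

DisjointChains : (m : ℕ) (τ : Fin m → List ℕ) → POP (totalLen m τ)
DisjointChains m τ = ChainsPOP (totalLen m τ) (chainsOf m τ)

-- Exponential generating functions, as coefficient sequences:
-- the sequence f represents Σ f(n) xⁿ/n!.

EGF : Set
EGF = ℕ → ℤ

egf : (ℕ → ℕ) → EGF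
egf c n = + (c n)

sumTo : ℕ → (ℕ → ℤ) → ℤ
sumTo zero h = h 0
sumTo (suc n) h = sumTo n h ℤ.+ h (suc n)

oneE : EGF
oneE zero = 1ℤ
oneE (suc n) = 0ℤ

_+E_ : EGF → EGF → EGF
(f +E g) n = f n ℤ.+ g n

_-E_ : EGF → EGF → EGF
(f -E g) n = f n ℤ.- g n

_*E_ : EGF → EGF → EGF
(f *E g) n = sumTo n λ j → + (n C j) ℤ.* f j ℤ.* g (n ∸ j)

-- multiplication by x
xE : EGF → EGF
xE f zero = 0ℤ
xE f (suc n) = + (suc n) ℤ.* f n

zeroE : EGF
zeroE n = 0ℤ

sumE : (m : ℕ) → (Fin m → EGF) → EGF
sumE zero F = zeroE
sumE (suc m) F = F Fin.zero +E sumE m (λ i → F (Fin.suc i))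

prodE : (m : ℕ) → (Fin m → EGF) → EGF
prodE zero F = oneE
prodE (suc m) F = F Fin.zero *E prodE m (λ i → F (Fin.suc i))

factorE : EGF → EGF
factorE A = (xE A -E A) +E oneE

chainFormula : (m : ℕ) → (Fin m → EGF) → EGF
chainFormula m A =
  sumE m λ i → A i *E prodE (toℕ i) (λ j → factorE (A (inject j)))

module Submission where

-- Write p = [σ, ρ] with σ the first chain and ρ the remaining ones. A permutation avoiding p either
-- avoids σ, or has a shortest prefix containing σ, of some length t ≥ 1. In the second case it is
-- determined by the set of values of that prefix (n choose t), the pattern of the prefix, and the
-- pattern of the other n − t entries. The prefix pattern is a permutation of [t] containing σ but not
-- within its first t − 1 entries; appending a last entry to the avoiders of σ of length t − 1 shows
-- there are t·A(t−1) − A(t) of them, the coefficient of xᵗ/t! in (x − 1)A(x) + 1. Because the chains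
-- of p are incomparable, the rest must avoid exactly ρ: an occurrence of ρ there would extend the
-- occurrence of σ in the prefix, while in any occurrence of p the ρ-part lies after the prefix.
-- So the EGF of the avoiders of p is A + ((x − 1)A + 1)·A_ρ, and induction on m gives the formula.

open import Defs
open import Data.Nat using (ℕ; zero; suc; _≤_)
open import Data.Fin using (Fin)
open import Data.List using (List)
open import Data.Product using (Σ; _×_; _,_)
import Data.Integer as ℤ
open import Function using (_∘_)
open import Relation.Binary.PropositionalEquality using (_≡_; refl; trans; cong; module ≡-Reasoning)

-- Commutativity, unit and associativity of the binomial convolution are proved by
-- induction on the degree through the Leibniz rule, so no binomial sum is ever reindexed.
module EGFAlgebra where

  open import Data.Nat as ℕ using (zero; suc; _∸_; _≤_; z≤n)
  open import Data.Nat.Properties as ℕP using ()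
  open import Data.Nat.Combinatorics using (_C_; nCk+nC[k+1]≡[n+1]C[k+1]; k>n⇒nCk≡0)
  open import Data.Integer using (ℤ; +_; 0ℤ; 1ℤ; _+_; _*_)
  open import Data.Integer.Properties as ℤP using ()
  open import Data.Integer.Solver using (module +-*-Solver)
  open import Data.Fin as Fin using (toℕ; inject)
  open import Function using (_∘_)
  open import Relation.Binary.PropositionalEquality
  open +-*-Solver
  open ≡-Reasoning

  infix 4 _≗E_

  _≗E_ : EGF → EGF → Set
  f ≗E g = ∀ n → f n ≡ g n

  derivE : EGF → EGF
  derivE f n = f (suc n)

  sumTo-cong : ∀ n {h h′ : ℕ → ℤ} → (∀ j → j ≤ n → h j ≡ h′ j) → sumTo n h ≡ sumTo n h′
  sumTo-cong zero    eq = eq 0 z≤n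
  sumTo-cong (suc n) eq =
    cong₂ _+_ (sumTo-cong n (λ j j≤n → eq j (ℕP.m≤n⇒m≤1+n j≤n))) (eq (suc n) ℕP.≤-refl)

  sumTo-suc : ∀ n h → sumTo (suc n) h ≡ h 0 + sumTo n (h ∘ suc)
  sumTo-suc zero    h = refl
  sumTo-suc (suc n) h = begin
    sumTo (suc n) h + h (suc (suc n))         ≡⟨ cong (_+ h (suc (suc n))) (sumTo-suc n h) ⟩
    (h 0 + sumTo n (h ∘ suc)) + h (suc (suc n)) ≡⟨ ℤP.+-assoc (h 0) _ _ ⟩
    h 0 + (sumTo n (h ∘ suc) + h (suc (suc n))) ∎

  sumTo-+ : ∀ n h h′ → sumTo n (λ j → h j + h′ j) ≡ sumTo n h + sumTo n h′
  sumTo-+ zero    h h′ = refl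
  sumTo-+ (suc n) h h′ = trans (cong (_+ (h (suc n) + h′ (suc n))) (sumTo-+ n h h′))
    (solve 4 (λ a b c d → (a :+ b) :+ (c :+ d) := (a :+ c) :+ (b :+ d)) refl
      (sumTo n h) (sumTo n h′) (h (suc n)) (h′ (suc n)))

  sumTo-zero : ∀ n h → (∀ j → h j ≡ 0ℤ) → sumTo n h ≡ 0ℤ
  sumTo-zero zero    h eq = eq 0
  sumTo-zero (suc n) h eq = cong₂ _+_ (sumTo-zero n h eq) (eq (suc n))

  *E-leibniz : ∀ f g n → (f *E g) (suc n) ≡ (derivE f *E g) n + (f *E derivE g) n
  *E-leibniz f g n = begin
    sumTo (suc n) T                                      ≡⟨ sumTo-cong (suc n) pascal ⟩
    sumTo (suc n) (λ j → U j + V j)                      ≡⟨ sumTo-+ (suc n) U V ⟩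
    sumTo (suc n) U + sumTo (suc n) V                    ≡⟨ cong (_+ sumTo (suc n) V) (sumTo-suc n U) ⟩
    (0ℤ + sumTo n (U ∘ suc)) + (sumTo n V + V (suc n))   ≡⟨ cong₂ _+_ (ℤP.+-identityˡ (sumTo n (U ∘ suc))) (cong (_+_ (sumTo n V)) V-top) ⟩
    sumTo n (U ∘ suc) + (sumTo n V + 0ℤ)                 ≡⟨ cong₂ _+_ (sumTo-cong n U-shift) (trans (ℤP.+-identityʳ _) (sumTo-cong n V-shift)) ⟩
    (derivE f *E g) n + (f *E derivE g) n                ∎
    where
    T = λ j → + (suc n C j) * f j * g (suc n ∸ j)
    U : ℕ → ℤ
    U zero    = 0ℤ
    U (suc j) = + (n C j) * f (suc j) * g (n ∸ j)
    V = λ j → + (n C j) * f j * g (suc n ∸ j)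
    V-top : V (suc n) ≡ 0ℤ
    V-top rewrite k>n⇒nCk≡0 (ℕP.n<1+n n) = refl
    U-shift : ∀ j → j ≤ n → U (suc j) ≡ + (n C j) * f (suc j) * g (n ∸ j)
    U-shift j _ = refl
    V-shift : ∀ j → j ≤ n → V j ≡ + (n C j) * f j * g (suc (n ∸ j))
    V-shift j j≤n = cong (λ z → + (n C j) * f j * g z) (ℕP.+-∸-assoc 1 j≤n)
    pascal : ∀ j → j ≤ suc n → T j ≡ U j + V j
    pascal zero    _ = sym (ℤP.+-identityˡ _)
    pascal (suc j) _ = begin
      + (suc n C suc j) * f (suc j) * g (n ∸ j)
        ≡⟨ cong (λ z → + z * f (suc j) * g (n ∸ j)) (sym (nCk+nC[k+1]≡[n+1]C[k+1] n j)) ⟩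
      + (n C j ℕ.+ n C suc j) * f (suc j) * g (n ∸ j)
        ≡⟨ cong (λ z → z * f (suc j) * g (n ∸ j)) (ℤP.pos-+ (n C j) (n C suc j)) ⟩
      (+ (n C j) + + (n C suc j)) * f (suc j) * g (n ∸ j)
        ≡⟨ solve 4 (λ a b x y → (a :+ b) :* x :* y := a :* x :* y :+ b :* x :* y) refl
             (+ (n C j)) (+ (n C suc j)) (f (suc j)) (g (n ∸ j)) ⟩
      U (suc j) + V (suc j) ∎

  *E-cong : ∀ {f f′ g g′} → f ≗E f′ → g ≗E g′ → f *E g ≗E f′ *E g′
  *E-cong {f} {f′} {g} {g′} f≗f′ g≗g′ n =
    sumTo-cong n (λ j _ → cong₂ (λ a b → + (n C j) * a * b) (f≗f′ j) (g≗g′ (n ∸ j)))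

  *E-zeroˡ : ∀ g → zeroE *E g ≗E zeroE
  *E-zeroˡ g n = sumTo-zero n _ λ j →
    trans (cong (_* g (n ∸ j)) (ℤP.*-zeroʳ (+ (n C j)))) (ℤP.*-zeroˡ (g (n ∸ j)))

  *E-distribˡ-+E : ∀ f g h → f *E (g +E h) ≗E (f *E g) +E (f *E h)
  *E-distribˡ-+E f g h n = trans
    (sumTo-cong n λ j _ → solve 4 (λ c a x y → c :* a :* (x :+ y) := c :* a :* x :+ c :* a :* y) refl
      (+ (n C j)) (f j) (g (n ∸ j)) (h (n ∸ j)))
    (sumTo-+ n _ _)

  *E-distribʳ-+E : ∀ f g h → (g +E h) *E f ≗E (g *E f) +E (h *E f)
  *E-distribʳ-+E f g h n = trans
    (sumTo-cong n λ j _ → solve 4 (λ c a x y → c :* (x :+ y) :* a := c :* x :* a :+ c :* y :* a) refl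
      (+ (n C j)) (f (n ∸ j)) (g j) (h j))
    (sumTo-+ n _ _)

  *E-comm : ∀ f g → f *E g ≗E g *E f
  *E-comm f g zero    = solve 2 (λ a b → con 1ℤ :* a :* b := con 1ℤ :* b :* a) refl (f 0) (g 0)
  *E-comm f g (suc n) = begin
    (f *E g) (suc n)                                ≡⟨ *E-leibniz f g n ⟩
    (derivE f *E g) n + (f *E derivE g) n           ≡⟨ cong₂ _+_ (*E-comm (derivE f) g n) (*E-comm f (derivE g) n) ⟩
    (g *E derivE f) n + (derivE g *E f) n           ≡⟨ ℤP.+-comm ((g *E derivE f) n) _ ⟩
    (derivE g *E f) n + (g *E derivE f) n           ≡⟨ *E-leibniz g f n ⟨
    (g *E f) (suc n)                                ∎

  *E-zeroʳ : ∀ g → g *E zeroE ≗E zeroE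
  *E-zeroʳ g n = trans (*E-comm g zeroE n) (*E-zeroˡ g n)

  *E-identityˡ : ∀ g → oneE *E g ≗E g
  *E-identityˡ g zero    = ℤP.*-identityˡ (g 0)
  *E-identityˡ g (suc n) = begin
    (oneE *E g) (suc n)                             ≡⟨ *E-leibniz oneE g n ⟩
    (derivE oneE *E g) n + (oneE *E derivE g) n     ≡⟨ cong₂ _+_ (*E-zeroˡ g n) (*E-identityˡ (derivE g) n) ⟩
    0ℤ + g (suc n)                                  ≡⟨ ℤP.+-identityˡ _ ⟩
    g (suc n)                                       ∎

  *E-identityʳ : ∀ g → g *E oneE ≗E g
  *E-identityʳ g n = trans (*E-comm g oneE n) (*E-identityˡ g n)

  *E-assoc : ∀ f g h → (f *E g) *E h ≗E f *E (g *E h)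
  *E-assoc f g h zero    =
    solve 3 (λ a b c → con 1ℤ :* (con 1ℤ :* a :* b) :* c := con 1ℤ :* a :* (con 1ℤ :* b :* c)) refl
      (f 0) (g 0) (h 0)
  *E-assoc f g h (suc n) = begin
    ((f *E g) *E h) (suc n)
      ≡⟨ *E-leibniz (f *E g) h n ⟩
    (derivE (f *E g) *E h) n + ((f *E g) *E h′) n
      ≡⟨ cong (_+ ((f *E g) *E h′) n) (*E-cong {g = h} {g′ = h} (*E-leibniz f g) (λ _ → refl) n) ⟩
    (((f′ *E g) +E (f *E g′)) *E h) n + ((f *E g) *E h′) n
      ≡⟨ cong (_+ ((f *E g) *E h′) n) (*E-distribʳ-+E h (f′ *E g) (f *E g′) n) ⟩
    (((f′ *E g) *E h) n + ((f *E g′) *E h) n) + ((f *E g) *E h′) n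
      ≡⟨ ℤP.+-assoc (((f′ *E g) *E h) n) _ _ ⟩
    ((f′ *E g) *E h) n + (((f *E g′) *E h) n + ((f *E g) *E h′) n)
      ≡⟨ cong₂ _+_ (*E-assoc f′ g h n) (cong₂ _+_ (*E-assoc f g′ h n) (*E-assoc f g h′ n)) ⟩
    (f′ *E (g *E h)) n + ((f *E (g′ *E h)) n + (f *E (g *E h′)) n)
      ≡⟨ cong (_+_ ((f′ *E (g *E h)) n)) (*E-distribˡ-+E f (g′ *E h) (g *E h′) n) ⟨
    (f′ *E (g *E h)) n + (f *E ((g′ *E h) +E (g *E h′))) n
      ≡⟨ cong (_+_ ((f′ *E (g *E h)) n)) (*E-cong {f} {f} (λ _ → refl) (*E-leibniz g h) n) ⟨
    (f′ *E (g *E h)) n + (f *E derivE (g *E h)) n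
      ≡⟨ *E-leibniz f (g *E h) n ⟨
    (f *E (g *E h)) (suc n) ∎
    where
    f′ = derivE f
    g′ = derivE g
    h′ = derivE h

  *E-leftComm : ∀ f g h → f *E (g *E h) ≗E g *E (f *E h)
  *E-leftComm f g h n = begin
    (f *E (g *E h)) n   ≡⟨ *E-assoc f g h n ⟨
    ((f *E g) *E h) n   ≡⟨ *E-cong {g = h} {g′ = h} (*E-comm f g) (λ _ → refl) n ⟩
    ((g *E f) *E h) n   ≡⟨ *E-assoc g f h n ⟩
    (g *E (f *E h)) n   ∎

  sumE-cong : ∀ m {F G : Fin m → EGF} → (∀ i → F i ≗E G i) → sumE m F ≗E sumE m G
  sumE-cong zero    eq n = refl
  sumE-cong (suc m) eq n = cong₂ _+_ (eq Fin.zero n) (sumE-cong m (eq ∘ Fin.suc) n)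

  *E-distribˡ-sumE : ∀ m f (G : Fin m → EGF) → f *E sumE m G ≗E sumE m (λ i → f *E G i)
  *E-distribˡ-sumE zero    f G n = *E-zeroʳ f n
  *E-distribˡ-sumE (suc m) f G n = trans (*E-distribˡ-+E f (G Fin.zero) (sumE m (G ∘ Fin.suc)) n)
    (cong (_+_ ((f *E G Fin.zero) n)) (*E-distribˡ-sumE m f (G ∘ Fin.suc) n))

  chainFormula-suc : ∀ m (A : Fin (suc m) → EGF) →
    chainFormula (suc m) A ≗E A Fin.zero +E (factorE (A Fin.zero) *E chainFormula m (A ∘ Fin.suc))
  chainFormula-suc m A n = cong₂ _+_ (*E-identityʳ (A Fin.zero) n) (begin
    sumE m (λ i → A (Fin.suc i) *E (F *E P i)) n
      ≡⟨ sumE-cong m (λ i → *E-leftComm (A (Fin.suc i)) F (P i)) n ⟩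
    sumE m (λ i → F *E (A (Fin.suc i) *E P i)) n
      ≡⟨ *E-distribˡ-sumE m F (λ i → A (Fin.suc i) *E P i) n ⟨
    (F *E chainFormula m (A ∘ Fin.suc)) n ∎)
    where
    F = factorE (A Fin.zero)
    P : Fin m → EGF
    P i = prodE (toℕ i) (λ j → factorE (A (Fin.suc (inject j))))


module Cardinality where

  open import Data.Nat using (zero; suc; _+_; _*_)
  open import Data.Nat.Properties using (+-0-monoid)
  open import Algebra.Properties.Monoid.Sum +-0-monoid using (sum)
  open import Data.Fin.Properties using (+↔⊎; *↔×)
  open import Data.Fin.Permutation using (↔⇒≡)
  open import Data.Sum using (_⊎_; inj₁; inj₂)
  open import Data.Product using (Σ; _×_; _,_; proj₁; proj₂)
  open import Data.Unit using (⊤; tt)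
  open import Data.Empty using (⊥-elim; ⊥-elim-irr)
  open import Data.Refinement using (Refinement-syntax; _,_; value; value-injective; refine)
  open import Data.Irrelevant using (Irrelevant; [_])
  open import Function using (_∘_)
  open import Function.Bundles using (_↔_; Inverse; mk↔ₛ′)
  open import Function.Properties.Inverse using (↔-sym; ↔-trans)
  open import Data.Sum.Function.Propositional using (_⊎-↔_)
  open import Data.Product.Function.NonDependent.Propositional using (_×-↔_)
  open import Relation.Binary.PropositionalEquality
  open import Relation.Nullary using (¬_; Dec; yes; no)
  open import Relation.Unary using (Decidable)

  Card : Set → ℕ → Set
  Card X k = Fin k ↔ X

  card-unique : ∀ {X a b} → Card X a → Card X b → a ≡ b
  card-unique ea eb = ↔⇒≡ (↔-trans ea (↔-sym eb))

  card-⊎ : ∀ {X Y a b} → Card X a → Card Y b → Card (X ⊎ Y) (a + b)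
  card-⊎ {a = a} ca cb = ↔-trans (+↔⊎ {a}) (ca ⊎-↔ cb)

  card-× : ∀ {X Y a b} → Card X a → Card Y b → Card (X × Y) (a * b)
  card-× {a = a} ca cb = ↔-trans (*↔× {a}) (ca ×-↔ cb)

  card-empty : ∀ {X} → ¬ X → Card X 0
  card-empty ¬x = mk↔ₛ′ (λ ()) (⊥-elim ∘ ¬x) (⊥-elim ∘ ¬x) (λ ())

  card-singleton : ∀ {X} (x : X) → (∀ y → y ≡ x) → Card X 1
  card-singleton x unique = mk↔ₛ′ (λ _ → x) (λ _ → Fin.zero) (sym ∘ unique) λ { Fin.zero → refl ; (Fin.suc ()) }

  Σ-Fin-suc-↔ : ∀ {m} (P : Fin (suc m) → Set) → (P Fin.zero ⊎ Σ (Fin m) (P ∘ Fin.suc)) ↔ Σ (Fin (suc m)) P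
  Σ-Fin-suc-↔ P = mk↔ₛ′ from to
    (λ { (Fin.zero , _) → refl ; (Fin.suc i , _) → refl }) (λ { (inj₁ _) → refl ; (inj₂ _) → refl })
    where
    from : _ → Σ _ P
    from (inj₁ x)       = Fin.zero , x
    from (inj₂ (i , x)) = Fin.suc i , x
    to : Σ _ P → _
    to (Fin.zero  , x) = inj₁ x
    to (Fin.suc i , x) = inj₂ (i , x)

  card-Σ : ∀ m (P : Fin m → Set) (f : Fin m → ℕ) → (∀ i → Card (P i) (f i)) → Card (Σ (Fin m) P) (sum f)
  card-Σ zero    P f c = card-empty λ { (() , _) }
  card-Σ (suc m) P f c =
    ↔-trans (card-⊎ (c Fin.zero) (card-Σ m (P ∘ Fin.suc) (f ∘ Fin.suc) (c ∘ Fin.suc))) (Σ-Fin-suc-↔ P)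

  refine-cong : ∀ {A : Set} {P Q : A → Set} → (∀ x → P x → Q x) → (∀ x → Q x → P x) →
    [ x ∈ A ∣ P x ] ↔ [ x ∈ A ∣ Q x ]
  refine-cong P⇒Q Q⇒P = mk↔ₛ′ (refine (P⇒Q _)) (refine (Q⇒P _)) (λ _ → refl) (λ _ → refl)

  refine-↔ : ∀ {A B : Set} (e : A ↔ B) (P : B → Set) → [ a ∈ A ∣ P (Inverse.to e a) ] ↔ [ b ∈ B ∣ P b ]
  refine-↔ e P = mk↔ₛ′
    (λ { (a , [ p ]) → to a , [ p ] })
    (λ { (b , [ p ]) → from b , [ subst P (sym (strictlyInverseˡ b)) p ] })
    (λ { (b , _) → value-injective (strictlyInverseˡ b) })
    (λ { (a , _) → value-injective (strictlyInverseʳ a) })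
    where open Inverse e

  refine-× : ∀ {A : Set} (P Q : A → Set) → [ y ∈ [ x ∈ A ∣ P x ] ∣ Q (value y) ] ↔ [ x ∈ A ∣ P x × Q x ]
  refine-× P Q = mk↔ₛ′
    (λ { ((x , [ p ]) , [ q ]) → x , [ p , q ] })
    (λ { (x , [ pq ]) → (x , [ proj₁ pq ]) , [ proj₂ pq ] })
    (λ _ → refl) (λ _ → refl)

  refine-×ʳ : ∀ {S A : Set} (Q : A → Set) → [ z ∈ S × A ∣ Q (proj₂ z) ] ↔ (S × [ a ∈ A ∣ Q a ])
  refine-×ʳ Q = mk↔ₛ′
    (λ { ((s , a) , q) → s , (a , q) })
    (λ { (s , (a , q)) → (s , a) , q })
    (λ _ → refl) (λ _ → refl)

  refine-⊗ : ∀ {A B : Set} (Q : A → Set) (R : B → Set) →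
    [ z ∈ A × B ∣ Q (proj₁ z) × R (proj₂ z) ] ↔ ([ a ∈ A ∣ Q a ] × [ b ∈ B ∣ R b ])
  refine-⊗ Q R = mk↔ₛ′
    (λ { ((a , b) , [ qr ]) → (a , [ proj₁ qr ]) , (b , [ proj₂ qr ]) })
    (λ { ((a , [ q ]) , (b , [ r ])) → (a , b) , [ q , r ] })
    (λ _ → refl) (λ _ → refl)

  refine-⊎ : ∀ {X : Set} (P : X → Set) → Decidable P → X ↔ ([ x ∈ X ∣ P x ] ⊎ [ x ∈ X ∣ ¬ P x ])
  refine-⊎ {X} P P? = mk↔ₛ′ to value′ to∘value′ value′∘to
    where
    to : X → _
    to x with P? x
    ... | yes p  = inj₁ (x , [ p ])
    ... | no  ¬p = inj₂ (x , [ ¬p ])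
    value′ : _ → X
    value′ (inj₁ y) = value y
    value′ (inj₂ y) = value y
    to∘value′ : ∀ y → to (value′ y) ≡ y
    to∘value′ (inj₁ (x , [ p ])) with P? x
    ... | yes _  = refl
    ... | no  ¬p = ⊥-elim-irr (¬p p)
    to∘value′ (inj₂ (x , [ ¬p ])) with P? x
    ... | yes p = ⊥-elim-irr (¬p p)
    ... | no  _ = refl
    value′∘to : ∀ x → value′ (to x) ≡ x
    value′∘to x with P? x
    ... | yes _ = refl
    ... | no  _ = refl

  refine-Fin-suc : ∀ {N} (P : Fin (suc N) → Set) →
    [ i ∈ Fin (suc N) ∣ P i ] ↔ ([ _ ∈ ⊤ ∣ P Fin.zero ] ⊎ [ i ∈ Fin N ∣ P (Fin.suc i) ])
  refine-Fin-suc P = mk↔ₛ′ to from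
    (λ { (inj₁ _) → refl ; (inj₂ _) → refl }) (λ { (Fin.zero , _) → refl ; (Fin.suc _ , _) → refl })
    where
    to : [ i ∈ Fin _ ∣ P i ] → _
    to (Fin.zero  , p) = inj₁ (tt , p)
    to (Fin.suc i , p) = inj₂ (i , p)
    from : _ → [ i ∈ Fin _ ∣ P i ]
    from (inj₁ (_ , p)) = Fin.zero , p
    from (inj₂ (i , p)) = Fin.suc i , p

  card-refine-⊤ : {P : Set} → Dec P → Σ ℕ (Card [ _ ∈ ⊤ ∣ P ])
  card-refine-⊤ (yes p) = 1 , card-singleton (tt , [ p ]) (λ { (tt , _) → refl })
  card-refine-⊤ (no ¬p) = 0 , card-empty λ { (_ , [ p ]) → ⊥-elim-irr (¬p p) }

  card-refine-Fin : ∀ N (P : Fin N → Set) → Decidable P → Σ ℕ (Card [ i ∈ Fin N ∣ P i ])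
  card-refine-Fin zero    P P? = 0 , card-empty λ { (() , _) }
  card-refine-Fin (suc N) P P? with card-refine-⊤ (P? Fin.zero) | card-refine-Fin N (P ∘ Fin.suc) (P? ∘ Fin.suc)
  ... | a , ca | b , cb = a + b , ↔-trans (card-⊎ ca cb) (↔-sym (refine-Fin-suc P))

  card-refine : ∀ {X N} → Card X N → (P : X → Set) → Decidable P → Σ ℕ (Card [ x ∈ X ∣ P x ])
  card-refine {N = N} cX P P? with card-refine-Fin N (P ∘ Inverse.to cX) (P? ∘ Inverse.to cX)
  ... | a , ca = a , ↔-trans ca (refine-↔ cX P)

  card-refine-complement : ∀ {X N a b} (P : X → Set) → Decidable P → Card X N →
    Card [ x ∈ X ∣ P x ] a → Card [ x ∈ X ∣ ¬ P x ] b → a + b ≡ N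
  card-refine-complement P P? cX ca cb = card-unique (card-⊎ ca cb) (↔-trans cX (refine-⊎ P P?))

  Σ-fibres-↔ : ∀ {X : Set} {T : ℕ} (Q : X → Set) (P : Fin T → X → Set)
    (index : (x : X) → .(Q x) → Fin T) →
    (∀ x → .(q : Q x) → Irrelevant (P (index x q) x)) →
    (∀ t x → .(q : Q x) → .(P t x) → index x q ≡ t) →
    (∀ t x → P t x → Q x) →
    [ x ∈ X ∣ Q x ] ↔ Σ (Fin T) (λ t → [ x ∈ X ∣ P t x ])
  Σ-fibres-↔ {X} Q P index in-fibre unique P⇒Q = mk↔ₛ′ to from to∘from (λ _ → refl)
    where
    to : [ x ∈ X ∣ Q x ] → Σ _ (λ t → [ x ∈ X ∣ P t x ])
    to (x , [ q ]) = index x q , (x , in-fibre x q)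
    from : Σ _ (λ t → [ x ∈ X ∣ P t x ]) → [ x ∈ X ∣ Q x ]
    from (t , (x , [ p ])) = x , [ P⇒Q t x p ]
    to∘from : ∀ y → to (from y) ≡ y
    to∘from (t , (x , [ p ])) = fibre-≡ (unique t x (P⇒Q t x p) p) refl
      where
      fibre-≡ : ∀ {s s′} {y : [ x ∈ X ∣ P s x ]} {y′ : [ x ∈ X ∣ P s′ x ]} →
        s ≡ s′ → value y ≡ value y′ → _≡_ {A = Σ _ (λ t → [ x ∈ X ∣ P t x ])} (s , y) (s′ , y′)
      fibre-≡ {y = v , _} {y′ = .v , _} refl refl = refl


module BoolVectors where

  open Cardinality
  open import Data.Nat using (zero; suc; _+_; _≤_; _<_; z≤n; s≤s)
  open import Data.Nat.Properties as ℕP using ()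
  open import Data.Nat.Combinatorics using (_C_; nCk+nC[k+1]≡[n+1]C[k+1])
  open import Data.Fin as Fin using (toℕ)
  open import Data.Fin.Properties using (toℕ-injective)
  open import Data.Bool using (Bool; true; false; not)
  open import Data.Vec using (Vec; []; _∷_; lookup; map)
  open import Data.Sum using (_⊎_; inj₁; inj₂)
  open import Data.Refinement using (Refinement-syntax; _,_)
  open import Data.Irrelevant using ([_])
  open import Function.Bundles using (mk↔ₛ′)
  open import Function.Properties.Inverse using (↔-trans)
  open import Relation.Binary.PropositionalEquality
  open import Relation.Binary.Definitions using (tri<; tri≈; tri>)
  open import Relation.Nullary using (contradiction)

  trues : ∀ {n} → Vec Bool n → ℕ
  trues []           = 0
  trues (true  ∷ s)  = suc (trues s)
  trues (false ∷ s)  = trues s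

  rank : ∀ {n} → Vec Bool n → Fin n → ℕ
  rank (b     ∷ s) Fin.zero    = 0
  rank (true  ∷ s) (Fin.suc v) = suc (rank s v)
  rank (false ∷ s) (Fin.suc v) = rank s v

  select : ∀ {n} (s : Vec Bool n) → Fin (trues s) → Fin n
  select (true  ∷ s) Fin.zero    = Fin.zero
  select (true  ∷ s) (Fin.suc r) = Fin.suc (select s r)
  select (false ∷ s) r           = Fin.suc (select s r)

  rank<trues : ∀ {n} (s : Vec Bool n) v → lookup s v ≡ true → rank s v < trues s
  rank<trues (true  ∷ s) Fin.zero    _  = s≤s z≤n
  rank<trues (true  ∷ s) (Fin.suc v) sv = s≤s (rank<trues s v sv)
  rank<trues (false ∷ s) (Fin.suc v) sv = rank<trues s v sv

  lookup-select : ∀ {n} (s : Vec Bool n) r → lookup s (select s r) ≡ true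
  lookup-select (true  ∷ s) Fin.zero    = refl
  lookup-select (true  ∷ s) (Fin.suc r) = lookup-select s r
  lookup-select (false ∷ s) r           = lookup-select s r

  rank-select : ∀ {n} (s : Vec Bool n) r → rank s (select s r) ≡ toℕ r
  rank-select (true  ∷ s) Fin.zero    = refl
  rank-select (true  ∷ s) (Fin.suc r) = cong suc (rank-select s r)
  rank-select (false ∷ s) r           = rank-select s r

  select-rank : ∀ {n} (s : Vec Bool n) v r → lookup s v ≡ true → toℕ r ≡ rank s v → select s r ≡ v
  select-rank (true  ∷ s) Fin.zero    Fin.zero    _  _  = refl
  select-rank (true  ∷ s) (Fin.suc v) (Fin.suc r) sv eq = cong Fin.suc (select-rank s v r sv (ℕP.suc-injective eq))
  select-rank (false ∷ s) (Fin.suc v) r           sv eq = cong Fin.suc (select-rank s v r sv eq)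

  rank-< : ∀ {n} (s : Vec Bool n) v v′ → lookup s v ≡ true → v Fin.< v′ → rank s v < rank s v′
  rank-< (true  ∷ s) Fin.zero    (Fin.suc v′) _  _         = s≤s z≤n
  rank-< (true  ∷ s) (Fin.suc v) (Fin.suc v′) sv (s≤s v<v′) = s≤s (rank-< s v v′ sv v<v′)
  rank-< (false ∷ s) (Fin.suc v) (Fin.suc v′) sv (s≤s v<v′) = rank-< s v v′ sv v<v′

  select-< : ∀ {n} (s : Vec Bool n) r r′ → r Fin.< r′ → select s r Fin.< select s r′
  select-< s r r′ r<r′ with ℕP.<-cmp (toℕ (select s r)) (toℕ (select s r′))
  ... | tri< lt _ _ = lt
  ... | tri≈ _ eq _ = contradiction r<r′ (ℕP.<-irrefl (begin
    toℕ r                 ≡⟨ rank-select s r ⟨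
    rank s (select s r)   ≡⟨ cong (rank s) (toℕ-injective eq) ⟩
    rank s (select s r′)  ≡⟨ rank-select s r′ ⟩
    toℕ r′                ∎))
    where open ≡-Reasoning
  ... | tri> _ _ gt = contradiction
    (subst₂ _<_ (rank-select s r′) (rank-select s r) (rank-< s _ _ (lookup-select s r′) gt)) (ℕP.<⇒≯ r<r′)

  trues-not : ∀ {n} (s : Vec Bool n) → trues s + trues (map not s) ≡ n
  trues-not []          = refl
  trues-not (true  ∷ s) = cong suc (trues-not s)
  trues-not (false ∷ s) = trans (ℕP.+-suc (trues s) _) (cong suc (trues-not s))

  Choose : ℕ → ℕ → Set
  Choose n j = [ s ∈ Vec Bool n ∣ trues s ≡ j ]

  card-Choose : ∀ n j → Card (Choose n j) (n C j)
  card-Choose zero    zero    = card-singleton ([] , [ refl ]) λ { ([] , _) → refl }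
  card-Choose zero    (suc j) = card-empty λ { ([] , [ () ]) }
  card-Choose (suc n) zero    = ↔-trans (card-Choose n zero) (mk↔ₛ′ cons uncons cons∘uncons (λ _ → refl))
    where
    cons : Choose n 0 → Choose (suc n) 0
    cons (s , [ p ]) = (false ∷ s) , [ p ]
    uncons : Choose (suc n) 0 → Choose n 0
    uncons ((false ∷ s) , [ p ]) = s , [ p ]
    uncons ((true  ∷ s) , [ () ])
    cons∘uncons : ∀ y → cons (uncons y) ≡ y
    cons∘uncons ((false ∷ s) , _) = refl
    cons∘uncons ((true  ∷ s) , [ () ])
  card-Choose (suc n) (suc j) = subst (Card (Choose (suc n) (suc j))) (nCk+nC[k+1]≡[n+1]C[k+1] n j)
    (↔-trans (card-⊎ (card-Choose n j) (card-Choose n (suc j))) (mk↔ₛ′ cons uncons cons∘uncons uncons∘cons))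
    where
    cons : Choose n j ⊎ Choose n (suc j) → Choose (suc n) (suc j)
    cons (inj₁ (s , [ p ])) = (true  ∷ s) , [ cong suc p ]
    cons (inj₂ (s , [ p ])) = (false ∷ s) , [ p ]
    uncons : Choose (suc n) (suc j) → Choose n j ⊎ Choose n (suc j)
    uncons ((true  ∷ s) , [ p ]) = inj₁ (s , [ ℕP.suc-injective p ])
    uncons ((false ∷ s) , [ p ]) = inj₂ (s , [ p ])
    cons∘uncons : ∀ y → cons (uncons y) ≡ y
    cons∘uncons ((true  ∷ s) , _) = refl
    cons∘uncons ((false ∷ s) , _) = refl
    uncons∘cons : ∀ x → uncons (cons x) ≡ x
    uncons∘cons (inj₁ _) = refl
    uncons∘cons (inj₂ _) = refl


module OrderPatterns where

  open BoolVectors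
  open import Data.Nat using (_<_)
  open import Data.Nat.Properties as ℕP using ()
  open import Data.Fin as Fin using (toℕ; fromℕ<; punchOut; _≟_)
  open import Data.Fin.Properties using (toℕ-injective; toℕ-fromℕ<; any?; pigeonhole; punchOut-injective)
  open import Data.Bool using (Bool; true; false)
  open import Data.Vec using (Vec; lookup; tabulate)
  open import Data.Vec.Properties using (lookup∘tabulate)
  open import Data.Product using (∃; _,_; proj₁; proj₂)
  open import Function using (_∘_)
  open import Relation.Binary.PropositionalEquality
  open import Relation.Binary.Definitions using (tri<; tri≈; tri>)
  open import Relation.Nullary using (yes; no; does; contradiction)
  open import Relation.Nullary.Decidable using (recompute)

  Inj : ∀ {a b} → (Fin a → Fin b) → Set
  Inj {a} w = ∀ (i j : Fin a) → w i ≡ w j → i ≡ j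

  Inj-recompute : ∀ {a b} {w : Fin a → Fin b} → .(Inj w) → Inj w
  Inj-recompute inj i j eq = recompute (i ≟ j) (inj i j eq)

  infix 4 _⊑_

  _⊑_ : ∀ {L N M} → (Fin L → Fin N) → (Fin L → Fin M) → Set
  u ⊑ v = ∀ i j → u i Fin.< u j → v i Fin.< v j

  Increasing : ∀ {a b} → (Fin a → Fin b) → Set
  Increasing h = (λ x → x) ⊑ h

  ⊑-trans : ∀ {L N M K} {u : Fin L → Fin N} {v : Fin L → Fin M} {w : Fin L → Fin K} → u ⊑ v → v ⊑ w → u ⊑ w
  ⊑-trans u⊑v v⊑w i j = v⊑w i j ∘ u⊑v i j

  ≗⇒⊑ : ∀ {L N} {u v : Fin L → Fin N} → (∀ i → u i ≡ v i) → u ⊑ v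
  ≗⇒⊑ u≗v i j = subst₂ Fin._<_ (u≗v i) (u≗v j)

  ⊑-∘ : ∀ {L N M} {h : Fin N → Fin M} (u : Fin L → Fin N) → Increasing h → u ⊑ (λ i → h (u i))
  ⊑-∘ u h↑ i j = h↑ (u i) (u j)

  ⊑-reverse : ∀ {L N M} {u : Fin L → Fin N} {v : Fin L → Fin M} → Inj u → u ⊑ v → v ⊑ u
  ⊑-reverse {u = u} {v} inj u⊑v i j vi<vj with ℕP.<-cmp (toℕ (u i)) (toℕ (u j))
  ... | tri< lt _ _ = lt
  ... | tri≈ _ eq _ = contradiction vi<vj (ℕP.<-irrefl (cong (toℕ ∘ v) (inj i j (toℕ-injective eq))))
  ... | tri> _ _ gt = contradiction (u⊑v j i gt) (ℕP.<⇒≯ vi<vj)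

  ⊑-injective : ∀ {L N M} {u : Fin L → Fin N} {v : Fin L → Fin M} → Inj u → u ⊑ v → Inj v
  ⊑-injective {u = u} inj u⊑v i j vi≡vj with ℕP.<-cmp (toℕ (u i)) (toℕ (u j))
  ... | tri< lt _ _ = contradiction (u⊑v i j lt) (ℕP.<-irrefl (cong toℕ vi≡vj))
  ... | tri≈ _ eq _ = inj i j (toℕ-injective eq)
  ... | tri> _ _ gt = contradiction (u⊑v j i gt) (ℕP.<-irrefl (cong toℕ (sym vi≡vj)))

  injective⇒surjective : ∀ {n} (π : Fin n → Fin n) → Inj π → ∀ v → ∃ λ i → π i ≡ v
  injective⇒surjective π inj v with any? (λ i → π i ≟ v)
  ... | yes hit = hit
  injective⇒surjective {suc n} π inj v | no miss =
    contradiction (inj i i′ (punchOut-injective (avoids i) (avoids i′) collide)) (ℕP.<⇒≢ i<i′ ∘ cong toℕ)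
    where
    avoids : ∀ i → v ≢ π i
    avoids i eq = miss (i , sym eq)
    pinched : Fin (suc n) → Fin n
    pinched i = punchOut (avoids i)
    i i′ : Fin (suc n)
    i   = proj₁ (pigeonhole (ℕP.n<1+n n) pinched)
    i′  = proj₁ (proj₂ (pigeonhole (ℕP.n<1+n n) pinched))
    i<i′ : i Fin.< i′
    i<i′ = proj₁ (proj₂ (proj₂ (pigeonhole (ℕP.n<1+n n) pinched)))
    collide : pinched i ≡ pinched i′
    collide = proj₂ (proj₂ (proj₂ (pigeonhole (ℕP.n<1+n n) pinched)))

  module Ranks {L n t : ℕ} (s : Vec Bool n) (w : Fin L → Fin n)
    (marked : ∀ i → lookup s (w i) ≡ true) (trues≡t : trues s ≡ t) where

    ranks : Fin L → Fin t
    ranks i = fromℕ< (subst (rank s (w i) <_) trues≡t (rank<trues s (w i) (marked i)))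

    toℕ-ranks : ∀ i → toℕ (ranks i) ≡ rank s (w i)
    toℕ-ranks i = toℕ-fromℕ< _

    w⊑ranks : w ⊑ ranks
    w⊑ranks i j lt = subst₂ _<_ (sym (toℕ-ranks i)) (sym (toℕ-ranks j)) (rank-< s (w i) (w j) (marked i) lt)

  image : ∀ {t n} → (Fin t → Fin n) → Vec Bool n
  image w = tabulate (λ v → does (any? (λ i → w i ≟ v)))

  image-preimage : ∀ {t n} (w : Fin t → Fin n) v → lookup (image w) v ≡ true → ∃ λ i → w i ≡ v
  image-preimage w v p rewrite lookup∘tabulate (λ v → does (any? (λ i → w i ≟ v))) v with any? (λ i → w i ≟ v)
  ... | yes hit = hit

  image-∋ : ∀ {t n} (w : Fin t → Fin n) i → lookup (image w) (w i) ≡ true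
  image-∋ w i rewrite lookup∘tabulate (λ v → does (any? (λ i → w i ≟ v))) (w i) with any? (λ j → w j ≟ w i)
  ... | yes _    = refl
  ... | no  miss = contradiction (i , refl) miss

  image-∌ : ∀ {t n} (w : Fin t → Fin n) v → (∀ i → w i ≢ v) → lookup (image w) v ≡ false
  image-∌ w v miss rewrite lookup∘tabulate (λ v → does (any? (λ i → w i ≟ v))) v with any? (λ i → w i ≟ v)
  ... | yes (i , hit) = contradiction hit (miss i)
  ... | no  _         = refl

  trues-image : ∀ {t n} (w : Fin t → Fin n) → Inj w → trues (image w) ≡ t
  trues-image {t} w inj = sym (card-unique (mk↔ₛ′ to from to∘from from∘to) ↔-refl)
    where
    open Cardinality using (card-unique)
    open import Function.Bundles using (mk↔ₛ′)
    open import Function.Properties.Inverse using (↔-refl)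
    s = image w
    preimage : (r : Fin (trues s)) → ∃ λ i → w i ≡ select s r
    preimage r = image-preimage w (select s r) (lookup-select s r)
    to : Fin t → Fin (trues s)
    to i = fromℕ< (rank<trues s (w i) (image-∋ w i))
    from : Fin (trues s) → Fin t
    from r = proj₁ (preimage r)
    to∘from : ∀ r → to (from r) ≡ r
    to∘from r = toℕ-injective (trans (toℕ-fromℕ< _) (trans (cong (rank s) (proj₂ (preimage r))) (rank-select s r)))
    from∘to : ∀ i → from (to i) ≡ i
    from∘to i = inj _ _ (trans (proj₂ (preimage (to i))) (select-rank s (w i) (to i) (image-∋ w i) (toℕ-fromℕ< _)))

  standardise : ∀ {t n} (w : Fin t → Fin n) → Inj w → Fin t → Fin t
  standardise w inj = Ranks.ranks (image w) w (image-∋ w) (trues-image w inj)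

  ⊑-standardise : ∀ {t n} (w : Fin t → Fin n) (inj : Inj w) → w ⊑ standardise w inj
  ⊑-standardise w inj = Ranks.w⊑ranks (image w) w (image-∋ w) (trues-image w inj)


-- Occurs R π is OccursIn R (lookup π) definitionally.
module Occurrences where

  open OrderPatterns
  open import Data.Nat using (suc; _≤_; _<_)
  open import Data.Nat.Properties as ℕP using ()
  open import Data.Fin as Fin using (toℕ; fromℕ<)
  open import Data.Fin.Properties using (toℕ<n; toℕ-fromℕ<; toℕ-injective)
  open import Data.Product using (Σ; _×_; _,_; proj₁)
  open import Function using (_∘_)
  open import Relation.Binary.PropositionalEquality
  open import Relation.Nullary using (¬_)

  OccursIn : ∀ {k L N} → POP k → (Fin L → Fin N) → Set
  OccursIn {k} {L} R w =
    Σ (Fin k → Fin L) λ ι →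
      (∀ a b → a Fin.< b → ι a Fin.< ι b) ×
      (∀ a b → R a b → w (ι a) Fin.< w (ι b))

  OccursBefore : ∀ {k L N} → POP k → (Fin L → Fin N) → ℕ → Set
  OccursBefore {k} {L} R w t =
    Σ (Fin k → Fin L) λ ι →
      (∀ a b → a Fin.< b → ι a Fin.< ι b) ×
      (∀ a b → R a b → w (ι a) Fin.< w (ι b)) ×
      (∀ a → toℕ (ι a) < t)

  module _ {k L N : ℕ} (R : POP k) where

    occursBefore⇒occursIn : ∀ {w : Fin L → Fin N} {t} → OccursBefore R w t → OccursIn R w
    occursBefore⇒occursIn (ι , ι↑ , rel , _) = ι , ι↑ , rel

    occursBefore-intro : ∀ {w : Fin L → Fin N} {t} (o : OccursIn R w) →
      (∀ a → toℕ (proj₁ o a) < t) → OccursBefore R w t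
    occursBefore-intro (ι , ι↑ , rel) bound = ι , ι↑ , rel , bound

    occursIn⇒occursBefore : ∀ {w : Fin L → Fin N} → OccursIn R w → OccursBefore R w L
    occursIn⇒occursBefore {w} o = occursBefore-intro {w = w} o (toℕ<n ∘ proj₁ o)

    occursBefore-mono : ∀ {w : Fin L → Fin N} {t t′} → t ≤ t′ → OccursBefore R w t → OccursBefore R w t′
    occursBefore-mono t≤t′ (ι , ι↑ , rel , bound) = ι , ι↑ , rel , λ a → ℕP.<-≤-trans (bound a) t≤t′

    occursIn-⊑ : ∀ {M} {u : Fin L → Fin N} {v : Fin L → Fin M} → u ⊑ v → OccursIn R u → OccursIn R v
    occursIn-⊑ u⊑v (ι , ι↑ , rel) = ι , ι↑ , λ a b r → u⊑v (ι a) (ι b) (rel a b r)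

    occursBefore-⊑ : ∀ {M t} {u : Fin L → Fin N} {v : Fin L → Fin M} → u ⊑ v → OccursBefore R u t → OccursBefore R v t
    occursBefore-⊑ u⊑v (ι , ι↑ , rel , bound) = ι , ι↑ , (λ a b r → u⊑v (ι a) (ι b) (rel a b r)) , bound

  ¬occursBefore-zero : ∀ {k L N} (R : POP k) {w : Fin L → Fin N} → 1 ≤ k → ¬ OccursBefore R w 0
  ¬occursBefore-zero {suc k} _ _ (_ , _ , _ , bound) with bound Fin.zero
  ... | ()

  module Prefix {k t L N : ℕ} (R : POP k) (w : Fin L → Fin N) (e : Fin t → Fin L)
    (toℕ-e : ∀ i → toℕ (e i) ≡ toℕ i) where

    occursBefore-prefix⁺ : ∀ {b} → OccursBefore R (w ∘ e) b → OccursBefore R w b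
    occursBefore-prefix⁺ (ι , ι↑ , rel , bound) =
      e ∘ ι , (λ a a′ lt → subst₂ _<_ (sym (toℕ-e (ι a))) (sym (toℕ-e (ι a′))) (ι↑ a a′ lt)) ,
      rel , λ a → subst (_< _) (sym (toℕ-e (ι a))) (bound a)

    occursBefore-prefix⁻ : ∀ {b} → b ≤ t → OccursBefore R w b → OccursBefore R (w ∘ e) b
    occursBefore-prefix⁻ {b} b≤t (ι , ι↑ , rel , bound) =
      ι′ , (λ a a′ lt → subst₂ _<_ (sym (toℕ-fromℕ< _)) (sym (toℕ-fromℕ< _)) (ι↑ a a′ lt)) ,
      (λ a a′ r → subst₂ (λ x y → w x Fin.< w y) (sym (e∘ι′ a)) (sym (e∘ι′ a′)) (rel a a′ r)) ,
      λ a → subst (_< b) (sym (toℕ-fromℕ< _)) (bound a)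
      where
      ι′ : Fin k → Fin t
      ι′ a = fromℕ< (ℕP.<-≤-trans (bound a) b≤t)
      e∘ι′ : ∀ a → e (ι′ a) ≡ ι a
      e∘ι′ a = toℕ-injective (trans (toℕ-e (ι′ a)) (toℕ-fromℕ< _))


module FinSplit where

  open import Data.Nat using (_+_)
  open import Data.Fin using (_↑ˡ_; _↑ʳ_; splitAt)
  open import Data.Fin.Properties using (splitAt⁻¹-↑ˡ; splitAt⁻¹-↑ʳ)
  open import Data.Sum using (inj₁; inj₂)
  open import Relation.Binary.PropositionalEquality using (subst)

  data SplitView (j k : ℕ) : Fin (j + k) → Set where
    left  : (a : Fin j) → SplitView j k (a ↑ˡ k)
    right : (b : Fin k) → SplitView j k (j ↑ʳ b)

  splitView : ∀ j k (x : Fin (j + k)) → SplitView j k x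
  splitView j k x with splitAt j x in eq
  ... | inj₁ a = subst (SplitView j k) (splitAt⁻¹-↑ˡ eq) (left a)
  ... | inj₂ b = subst (SplitView j k) (splitAt⁻¹-↑ʳ eq) (right b)


-- The disjoint chains POP on τ splits into its first chain σ, on the first k positions,
-- and the remaining chains ρ, on the last K positions, with no relations in between.
module ChainSplit (m : ℕ) (τ : Fin (suc m) → List ℕ) (τ-perm : ∀ i → IsChainPerm (τ i)) where

  open Occurrences
  open FinSplit
  open import Data.Nat using (zero; suc; _+_; _≤_; _<_; z≤n; s≤s)
  open import Data.Nat.Properties as ℕP using ()
  open import Data.Fin as Fin using (toℕ; _↑ˡ_; _↑ʳ_; reduce≥)
  open import Data.Fin.Properties as FinP using (toℕ<n; toℕ-↑ˡ; toℕ-↑ʳ; all?; ¬∀⟶∃¬)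
  open import Data.List using ([]; _∷_; _++_; [_]; map; length)
  open import Data.List.Properties using (map-++; ∷-injectiveˡ; ∷-injectiveʳ)
  open import Data.List.Membership.Propositional using (_∈_)
  open import Data.List.Membership.Propositional.Properties using (∈-map⁺; ∈-map⁻; ∈-++⁺ʳ; ∈-upTo⁻)
  open import Data.List.Relation.Unary.Any using (here; there)
  open import Data.List.Relation.Binary.Permutation.Propositional.Properties using (∈-resp-↭)
  open import Data.Product using (Σ; _×_; _,_; proj₁; proj₂)
  open import Data.Empty using (⊥; ⊥-elim)
  open import Function using (_∘_)
  open import Relation.Binary.PropositionalEquality hiding ([_])
  open import Relation.Nullary using (¬_; yes; no)

  k : ℕ
  k = length (τ Fin.zero)

  K : ℕ
  K = totalLen m (τ ∘ Fin.suc)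

  p : POP (k + K)
  p = DisjointChains (suc m) τ

  σ : POP k
  σ = ChainPattern (τ Fin.zero)

  ρ : POP K
  ρ = DisjointChains m (τ ∘ Fin.suc)

  private
    higher∈ : ∀ {c xs ys zs : List ℕ} {x y} → c ≡ xs ++ [ y ] ++ ys ++ [ x ] ++ zs → y ∈ c
    higher∈ {xs = xs} refl = ∈-++⁺ʳ xs (here refl)

    lower∈ : ∀ {c xs ys zs : List ℕ} {x y} → c ≡ xs ++ [ y ] ++ ys ++ [ x ] ++ zs → x ∈ c
    lower∈ {xs = xs} {ys} refl = ∈-++⁺ʳ xs (there (∈-++⁺ʳ ys (here refl)))

    chainPerm-bounds : ∀ {c} → IsChainPerm c → ∀ {x} → x ∈ c → 1 ≤ x × x ≤ length c
    chainPerm-bounds (_ , c↭) x∈ with ∈-map⁻ suc (∈-resp-↭ c↭ x∈)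
    ... | y , y∈ , refl = s≤s z≤n , ∈-upTo⁻ y∈

    chainsOf-positive : ∀ m (τ : Fin m → List ℕ) → (∀ i → IsChainPerm (τ i)) →
      ∀ {c} → c ∈ chainsOf m τ → ∀ {x} → x ∈ c → 1 ≤ x
    chainsOf-positive (suc m) τ τ-perm (here refl) x∈ = proj₁ (chainPerm-bounds (τ-perm Fin.zero) x∈)
    chainsOf-positive (suc m) τ τ-perm (there c∈) x∈ with ∈-map⁻ (map (length (τ Fin.zero) +_)) c∈
    ... | c′ , c′∈ , refl with ∈-map⁻ (length (τ Fin.zero) +_) x∈
    ... | y , y∈ , refl =
      ℕP.≤-trans (chainsOf-positive m (τ ∘ Fin.suc) (τ-perm ∘ Fin.suc) c′∈ y∈) (ℕP.m≤n+m _ _)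

    map-≡-++-∷ : ∀ (f : ℕ → ℕ) c xs y rest → map f c ≡ xs ++ y ∷ rest →
      Σ (List ℕ) λ xs′ → Σ ℕ λ y′ → Σ (List ℕ) λ rest′ → c ≡ xs′ ++ y′ ∷ rest′ × f y′ ≡ y × map f rest′ ≡ rest
    map-≡-++-∷ f (c ∷ cs) []       y rest eq = [] , c , cs , refl , ∷-injectiveˡ eq , ∷-injectiveʳ eq
    map-≡-++-∷ f (c ∷ cs) (x ∷ xs) y rest eq with map-≡-++-∷ f cs xs y rest (∷-injectiveʳ eq)
    ... | xs′ , y′ , rest′ , c≡ , fy′ , rest≡ = c ∷ xs′ , y′ , rest′ , cong (c ∷_) c≡ , fy′ , rest≡

    rest-above : ∀ {c} → c ∈ map (map (k +_)) (chainsOf m (τ ∘ Fin.suc)) → ∀ {x} → x ∈ c → k < x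
    rest-above c∈ x∈ with ∈-map⁻ (map (k +_)) c∈
    ... | c′ , c′∈ , refl with ∈-map⁻ (k +_) x∈
    ... | y , y∈ , refl = subst (_≤ k + y) (ℕP.+-comm k 1)
      (ℕP.+-monoʳ-≤ k (chainsOf-positive m (τ ∘ Fin.suc) (τ-perm ∘ Fin.suc) c′∈ y∈))

    no-straddling : ∀ {c} → c ∈ chainsOf (suc m) τ → ∀ {u u′} → u ∈ c → u′ ∈ c → u ≤ k → k < u′ → ⊥
    no-straddling (here refl) u∈ u′∈ u≤k k<u′ = ℕP.<⇒≱ k<u′ (proj₂ (chainPerm-bounds (τ-perm Fin.zero) u′∈))
    no-straddling (there c∈)  u∈ u′∈ u≤k k<u′ = ℕP.<⇒≱ (rest-above c∈ u∈) u≤k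

    left≤k : ∀ (a : Fin k) → suc (toℕ (a ↑ˡ K)) ≤ k
    left≤k a = subst (λ z → suc z ≤ k) (sym (toℕ-↑ˡ a K)) (toℕ<n a)

    k<right : ∀ (b : Fin K) → k < suc (toℕ (k ↑ʳ b))
    k<right b = s≤s (subst (k ≤_) (sym (toℕ-↑ʳ k b)) (ℕP.m≤m+n k (toℕ b)))

    shift-right : ∀ (b : Fin K) → k + suc (toℕ b) ≡ suc (toℕ (k ↑ʳ b))
    shift-right b = trans (ℕP.+-suc k (toℕ b)) (cong suc (sym (toℕ-↑ʳ k b)))

  p-left⇒σ : ∀ a b → p (a ↑ˡ K) (b ↑ˡ K) → σ a b
  p-left⇒σ a b (c , here refl , xs , ys , zs , eq) = τ Fin.zero , here refl , xs , ys , zs ,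
    subst₂ (λ u v → τ Fin.zero ≡ xs ++ [ suc u ] ++ ys ++ [ suc v ] ++ zs) (toℕ-↑ˡ b K) (toℕ-↑ˡ a K) eq
  p-left⇒σ a b (c , there c∈ , xs , ys , zs , eq) = ⊥-elim (ℕP.<⇒≱ (rest-above c∈ (higher∈ eq)) (left≤k b))

  σ⇒p-left : ∀ a b → σ a b → p (a ↑ˡ K) (b ↑ˡ K)
  σ⇒p-left a b (c , here refl , xs , ys , zs , eq) = τ Fin.zero , here refl , xs , ys , zs ,
    subst₂ (λ u v → τ Fin.zero ≡ xs ++ [ suc u ] ++ ys ++ [ suc v ] ++ zs) (sym (toℕ-↑ˡ b K)) (sym (toℕ-↑ˡ a K)) eq

  ¬p-left-right : ∀ a b → ¬ p (a ↑ˡ K) (k ↑ʳ b)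
  ¬p-left-right a b (c , c∈ , _ , _ , _ , eq) = no-straddling c∈ (lower∈ eq) (higher∈ eq) (left≤k a) (k<right b)

  ¬p-right-left : ∀ a b → ¬ p (k ↑ʳ a) (b ↑ˡ K)
  ¬p-right-left a b (c , c∈ , _ , _ , _ , eq) = no-straddling c∈ (higher∈ eq) (lower∈ eq) (left≤k b) (k<right a)

  ρ⇒p-right : ∀ a b → ρ a b → p (k ↑ʳ a) (k ↑ʳ b)
  ρ⇒p-right a b (c , c∈ , xs , ys , zs , refl) =
    map (k +_) c , there (∈-map⁺ (map (k +_)) c∈) , map (k +_) xs , map (k +_) ys , map (k +_) zs ,
    trans (map-++ (k +_) xs _) (cong (map (k +_) xs ++_) (cong₂ _∷_ (shift-right b)
      (trans (map-++ (k +_) ys _) (cong (map (k +_) ys ++_) (cong₂ _∷_ (shift-right a) refl)))))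

  p-right⇒ρ : ∀ a b → p (k ↑ʳ a) (k ↑ʳ b) → ρ a b
  p-right⇒ρ a b (c , here refl , xs , ys , zs , eq) =
    ⊥-elim (ℕP.<⇒≱ (k<right b) (proj₂ (chainPerm-bounds (τ-perm Fin.zero) (higher∈ eq))))
  p-right⇒ρ a b (c , there c∈ , xs , ys , zs , eq) with ∈-map⁻ (map (k +_)) c∈
  ... | c′ , c′∈ , refl with map-≡-++-∷ (k +_) c′ xs _ _ eq
  ... | xs′ , b′ , rest , c′≡ , kb′ , rest≡ with map-≡-++-∷ (k +_) rest ys _ _ rest≡
  ... | ys′ , a′ , zs′ , rest≡′ , ka′ , refl = c′ , c′∈ , xs′ , ys′ , zs′ ,
    trans c′≡ (cong (xs′ ++_) (cong₂ _∷_ (ℕP.+-cancelˡ-≡ k _ _ (trans kb′ (sym (shift-right b)))) (trans rest≡′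
      (cong (ys′ ++_) (cong₂ _∷_ (ℕP.+-cancelˡ-≡ k _ _ (trans ka′ (sym (shift-right a)))) refl)))))

  private
    toℕ-left : ∀ (a : Fin k) → toℕ (a ↑ˡ K) ≡ toℕ a
    toℕ-left a = toℕ-↑ˡ a K

    toℕ-right : ∀ (b : Fin K) → toℕ (k ↑ʳ b) ≡ k + toℕ b
    toℕ-right b = toℕ-↑ʳ k b

  occursIn-first : ∀ {L N} {w : Fin L → Fin N} → OccursIn p w → OccursIn σ w
  occursIn-first (ι , ι↑ , rel) = (λ a → ι (a ↑ˡ K)) ,
    (λ a b lt → ι↑ (a ↑ˡ K) (b ↑ˡ K) (subst₂ _<_ (sym (toℕ-left a)) (sym (toℕ-left b)) lt)) ,
    (λ a b r → rel (a ↑ˡ K) (b ↑ˡ K) (σ⇒p-left a b r))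

  occursIn-join : ∀ {j n N} (w : Fin (j + n) → Fin N) →
    OccursBefore σ w j → OccursIn ρ (λ i → w (j ↑ʳ i)) → OccursIn p w
  occursIn-join {j} {n} w (ι₁ , ι₁↑ , rel₁ , bound₁) (ι₂ , ι₂↑ , rel₂) = ι , ι↑ , rel
    where
    ι : Fin (k + K) → Fin (j + n)
    ι x with splitView k K x
    ... | left  a = ι₁ a
    ... | right b = j ↑ʳ ι₂ b
    ι↑ : ∀ x y → x Fin.< y → ι x Fin.< ι y
    ι↑ x y x<y with splitView k K x | splitView k K y
    ... | left a  | left a′  = ι₁↑ a a′ (subst₂ _<_ (toℕ-left a) (toℕ-left a′) x<y)
    ... | left a  | right b  = ℕP.<-≤-trans (bound₁ a) (subst (j ≤_) (sym (toℕ-↑ʳ j (ι₂ b))) (ℕP.m≤m+n j _))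
    ... | right b | left a   = ⊥-elim (ℕP.<⇒≱ (subst₂ _<_ (toℕ-right b) (toℕ-left a) x<y)
                                 (ℕP.≤-trans (ℕP.<⇒≤ (toℕ<n a)) (ℕP.m≤m+n k _)))
    ... | right b | right b′ = subst₂ _<_ (sym (toℕ-↑ʳ j (ι₂ b))) (sym (toℕ-↑ʳ j (ι₂ b′)))
      (ℕP.+-monoʳ-< j (ι₂↑ b b′ (ℕP.+-cancelˡ-< k _ _ (subst₂ _<_ (toℕ-right b) (toℕ-right b′) x<y))))
    rel : ∀ x y → p x y → w (ι x) Fin.< w (ι y)
    rel x y r with splitView k K x | splitView k K y
    ... | left a  | left a′  = rel₁ a a′ (p-left⇒σ a a′ r)
    ... | left a  | right b  = ⊥-elim (¬p-left-right a b r)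
    ... | right b | left a   = ⊥-elim (¬p-right-left b a r)
    ... | right b | right b′ = rel₂ b b′ (p-right⇒ρ b b′ r)

  -- If the first j entries contain no σ, some σ-entry of any occurrence of p sits at position ≥ j,
  -- so its ρ-entries all lie after position j.
  occursIn-rest : ∀ {j n N} (w : Fin (suc j + n) → Fin N) →
    ¬ OccursBefore σ w j → OccursIn p w → OccursIn ρ (λ i → w (suc j ↑ʳ i))
  occursIn-rest {j} {n} w ¬σ (ι , ι↑ , rel) with all? (λ a → toℕ (ι (a ↑ˡ K)) ℕP.<? j)
  ... | yes before = ⊥-elim (¬σ (occursBefore-intro σ {w = w} (occursIn-first {w = w} (ι , ι↑ , rel)) before))
  ... | no ¬before with ¬∀⟶∃¬ k (λ a → toℕ (ι (a ↑ˡ K)) < j) (λ a → toℕ (ι (a ↑ˡ K)) ℕP.<? j) ¬before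
  ... | a , j≤ιa = ι₂ , ι₂↑ , rel₂
    where
    after : ∀ b → suc j ≤ toℕ (ι (k ↑ʳ b))
    after b = ℕP.≤-<-trans (ℕP.≮⇒≥ j≤ιa) (ι↑ (a ↑ˡ K) (k ↑ʳ b)
      (subst₂ _<_ (sym (toℕ-left a)) (sym (toℕ-right b)) (ℕP.<-≤-trans (toℕ<n a) (ℕP.m≤m+n k _))))
    ι₂ : Fin K → Fin n
    ι₂ b = reduce≥ (ι (k ↑ʳ b)) (after b)
    ι₂-shift : ∀ b → suc j ↑ʳ ι₂ b ≡ ι (k ↑ʳ b)
    ι₂-shift b = FinP.splitAt⁻¹-↑ʳ (FinP.splitAt-≥ (suc j) (ι (k ↑ʳ b)) (after b))
    toℕ-ι₂ : ∀ b → suc j + toℕ (ι₂ b) ≡ toℕ (ι (k ↑ʳ b))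
    toℕ-ι₂ b = trans (sym (toℕ-↑ʳ (suc j) (ι₂ b))) (cong toℕ (ι₂-shift b))
    ι₂↑ : ∀ b b′ → b Fin.< b′ → ι₂ b Fin.< ι₂ b′
    ι₂↑ b b′ b<b′ = ℕP.+-cancelˡ-< (suc j) _ _ (subst₂ _<_ (sym (toℕ-ι₂ b)) (sym (toℕ-ι₂ b′))
      (ι↑ _ _ (subst₂ _<_ (sym (toℕ-right b)) (sym (toℕ-right b′)) (ℕP.+-monoʳ-< k b<b′))))
    rel₂ : ∀ b b′ → ρ b b′ → w (suc j ↑ʳ ι₂ b) Fin.< w (suc j ↑ʳ ι₂ b′)
    rel₂ b b′ r rewrite ι₂-shift b | ι₂-shift b′ = rel (k ↑ʳ b) (k ↑ʳ b′) (ρ⇒p-right b b′ r)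


module Permutations where

  open Cardinality
  open OrderPatterns
  open Occurrences
  open import Data.Nat using (_≤_)
  open import Data.Nat.Properties using (≤-refl)
  open import Data.Fin as Fin using (_≟_; inject≤)
  open import Data.Fin.Properties using (any?; toℕ-injective; toℕ-inject≤)
  open import Data.Vec using (Vec; []; lookup; tabulate)
  open import Data.Vec.Properties using (lookup∘tabulate; tabulate∘lookup; tabulate-cong; ≡-dec)
  open import Data.Product using (_×_; _,_; proj₂)
  open import Data.Empty using (⊥-elim-irr)
  open import Data.Refinement using (Refinement-syntax; _,_; value; value-injective)
  open import Data.Irrelevant using ([_])
  open import Function using (_∘_; case_of_)
  open import Function.Bundles using (_↔_; Inverse)
  open import Function.Properties.Inverse using (↔-sym)
  open import Relation.Binary.PropositionalEquality
  open import Relation.Nullary using (¬_; Dec; yes; no)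
  open import Relation.Nullary.Decidable using (recompute)

  Perm : ℕ → Set
  Perm n = [ π ∈ Vec (Fin n) n ∣ IsPermutation π ]

  word : ∀ {n} → Perm n → Fin n → Fin n
  word x = lookup (value x)

  word-injective : ∀ {n} (x : Perm n) → Inj (word x)
  word-injective (_ , [ inj ]) = Inj-recompute inj

  Vec-ext : ∀ {A : Set} {n} {v w : Vec A n} → (∀ i → lookup v i ≡ lookup w i) → v ≡ w
  Vec-ext {v = v} {w} v≗w = trans (sym (tabulate∘lookup v)) (trans (tabulate-cong v≗w) (tabulate∘lookup w))

  Perm-ext : ∀ {n} {x y : Perm n} → .(∀ i → word x i ≡ word y i) → x ≡ y
  Perm-ext {x = x} {y} x≗y = value-injective (recompute (≡-dec _≟_ (value x) (value y)) (Vec-ext x≗y))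

  fromWord : ∀ {n} (f : Fin n → Fin n) → .(Inj f) → Perm n
  fromWord f inj = tabulate f , [ (λ i j eq → inj i j (trans (sym (lookup∘tabulate f i)) (trans eq (lookup∘tabulate f j)))) ]

  word-fromWord : ∀ {n} (f : Fin n → Fin n) .(inj : Inj f) i → word (fromWord f inj) i ≡ f i
  word-fromWord f inj = lookup∘tabulate f

  Av : ∀ {k} → POP k → ℕ → Set
  Av R n = [ x ∈ Perm n ∣ ¬ OccursIn R (word x) ]

  AvoidersOf↔Av : ∀ {k} (R : POP k) n → AvoidersOf R n ↔ Av R n
  AvoidersOf↔Av R n = ↔-sym (refine-× IsPermutation (Avoids R))

  counts-POP₀ : (R : POP 0) → Counts R (λ _ → 0)
  counts-POP₀ R n = card-empty λ { (_ , [ π-avoids ]) → ⊥-elim-irr (proj₂ π-avoids ((λ ()) , (λ ()) , (λ ()))) }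

  count-zero : ∀ {k} (R : POP k) {A : ℕ → ℕ} → 1 ≤ k → Counts R A → A 0 ≡ 1
  count-zero {suc k} R _ counts-A = card-unique (counts-A 0)
    (card-singleton ([] , [ (λ ()) , (λ { (ι , _) → case ι Fin.zero of λ () }) ]) λ { ([] , _) → refl })

  -- A POP relation need not be decidable; avoidance is decided instead by searching
  -- the finite list of avoiders that a counting sequence enumerates.
  module Decide {k} (R : POP k) (A : ℕ → ℕ) (counts : Counts R A) where

    avoids? : ∀ {n} (x : Perm n) → Dec (¬ OccursIn R (word x))
    avoids? {n} x with any? (λ i → ≡-dec _≟_ (value (Inverse.to (counts n) i)) (value x))
    ... | yes (i , eq) = yes (listed (Inverse.to (counts n) i) eq)
      where
      listed : (y : AvoidersOf R n) → value y ≡ value x → ¬ OccursIn R (word x)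
      listed (_ , [ av ]) refl o = ⊥-elim-irr (proj₂ av o)
    ... | no unlisted = no λ av → unlisted (Inverse.from (counts n) (asAvoider av) ,
                                             cong value (Inverse.strictlyInverseˡ (counts n) (asAvoider av)))
      where
      asAvoider : ¬ OccursIn R (word x) → AvoidersOf R n
      asAvoider av = value x , [ (λ i j → word-injective x i j) , av ]

    module _ {n} (x : Perm n) (t : ℕ) (t≤n : t ≤ n) where
      private
        w : Fin t → Fin n
        w = word x ∘ λ i → inject≤ i t≤n
        w-inj : Inj w
        w-inj i j eq = toℕ-injective (trans (sym (toℕ-inject≤ i t≤n))
          (trans (cong Fin.toℕ (word-injective x _ _ eq)) (toℕ-inject≤ j t≤n)))
        red-w : Perm t
        red-w = fromWord (standardise w w-inj) (⊑-injective w-inj (⊑-standardise w w-inj))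
        w⊑red-w : w ⊑ word red-w
        w⊑red-w = ⊑-trans (⊑-standardise w w-inj)
          (≗⇒⊑ (sym ∘ word-fromWord (standardise w w-inj) (⊑-injective w-inj (⊑-standardise w w-inj))))
        open Prefix R (word x) (λ i → inject≤ i t≤n) (λ i → toℕ-inject≤ i t≤n)

      avoidsBefore? : Dec (¬ OccursBefore R (word x) t)
      avoidsBefore? with avoids? red-w
      ... | yes av = yes λ ob → av (occursIn-⊑ R w⊑red-w (occursBefore⇒occursIn R {w = w} (occursBefore-prefix⁻ ≤-refl ob)))
      ... | no ¬av = no λ ¬ob → ¬av λ o → ¬ob (occursBefore-prefix⁺
                       (occursIn⇒occursBefore R {w = w} (occursIn-⊑ R (⊑-reverse w-inj w⊑red-w) o)))


module LastEntry where

  open Cardinality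
  open OrderPatterns
  open Occurrences
  open Permutations
  open import Data.Nat using (_+_; _*_)
  open import Data.Nat.Properties as ℕP using (≤-refl)
  open import Data.Fin as Fin using (fromℕ; inject₁; punchIn; punchOut)
  open import Data.Fin.Properties as FinP using (toℕ-inject₁; fromℕ≢inject₁; inject₁-injective; punchInᵢ≢i)
  open import Data.Fin.Relation.Unary.Top using (view; ‵fromℕ; ‵inject₁; view-fromℕ; view-inject₁)
  open import Data.Product using (Σ; _×_; _,_; proj₁; proj₂)
  open import Data.Empty using (⊥-elim)
  open import Data.Refinement using (Refinement-syntax; _,_; value)
  open import Function using (_∘_)
  open import Function.Bundles using (_↔_; mk↔ₛ′)
  open import Function.Properties.Inverse using (↔-refl; ↔-sym; ↔-trans)
  open import Relation.Binary.PropositionalEquality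
  open import Relation.Nullary using (¬_)
  open import Relation.Nullary.Decidable using (¬?)

  punchIn-increasing : ∀ {n} (v : Fin (suc n)) → Increasing (punchIn v)
  punchIn-increasing v x y x<y = FinP.≤∧≢⇒< (FinP.punchIn-mono-≤ v x y (ℕP.<⇒≤ x<y))
    (FinP.<⇒≢ x<y ∘ FinP.punchIn-injective v x y)

  module _ {j : ℕ} where

    appendWord : Fin (suc j) → Perm j → Fin (suc j) → Fin (suc j)
    appendWord v α x with view x
    ... | ‵fromℕ     = v
    ... | ‵inject₁ i = punchIn v (word α i)

    appendWord-inject₁ : ∀ v α i → appendWord v α (inject₁ i) ≡ punchIn v (word α i)
    appendWord-inject₁ v α i rewrite view-inject₁ i = refl

    appendWord-fromℕ : ∀ v α → appendWord v α (fromℕ j) ≡ v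
    appendWord-fromℕ v α rewrite view-fromℕ j = refl

    appendWord-injective : ∀ v α → Inj (appendWord v α)
    appendWord-injective v α x y eq with view x | view y
    ... | ‵inject₁ i | ‵inject₁ i′ = cong inject₁ (word-injective α i i′ (FinP.punchIn-injective v _ _ eq))
    ... | ‵inject₁ i | ‵fromℕ      = ⊥-elim (punchInᵢ≢i v (word α i) eq)
    ... | ‵fromℕ     | ‵inject₁ i  = ⊥-elim (punchInᵢ≢i v (word α i) (sym eq))
    ... | ‵fromℕ     | ‵fromℕ      = refl

    append : Fin (suc j) → Perm j → Perm (suc j)
    append v α = fromWord (appendWord v α) (appendWord-injective v α)

    word-append-inject₁ : ∀ v α i → word (append v α) (inject₁ i) ≡ punchIn v (word α i)
    word-append-inject₁ v α i =
      trans (word-fromWord (appendWord v α) (appendWord-injective v α) (inject₁ i)) (appendWord-inject₁ v α i)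

    word-append-fromℕ : ∀ v α → word (append v α) (fromℕ j) ≡ v
    word-append-fromℕ v α =
      trans (word-fromWord (appendWord v α) (appendWord-injective v α) (fromℕ j)) (appendWord-fromℕ v α)

    lastEntry : Perm (suc j) → Fin (suc j)
    lastEntry x = word x (fromℕ j)

    lastEntry≢ : ∀ x i → lastEntry x ≢ word x (inject₁ i)
    lastEntry≢ x i eq = fromℕ≢inject₁ (word-injective x _ _ eq)

    dropLastWord : Perm (suc j) → Fin j → Fin j
    dropLastWord x i = punchOut (lastEntry≢ x i)

    dropLastWord-injective : ∀ x → Inj (dropLastWord x)
    dropLastWord-injective x i i′ eq =
      inject₁-injective (word-injective x _ _ (FinP.punchOut-injective (lastEntry≢ x i) (lastEntry≢ x i′) eq))

    dropLast : Perm (suc j) → Perm j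
    dropLast x = fromWord (dropLastWord x) (dropLastWord-injective x)

    punchIn-dropLast : ∀ x i → punchIn (lastEntry x) (word (dropLast x) i) ≡ word x (inject₁ i)
    punchIn-dropLast x i = trans (cong (punchIn (lastEntry x)) (word-fromWord (dropLastWord x) (dropLastWord-injective x) i))
      (FinP.punchIn-punchOut (lastEntry≢ x i))

    append↔ : (Fin (suc j) × Perm j) ↔ Perm (suc j)
    append↔ = mk↔ₛ′ (λ (v , α) → append v α) (λ x → lastEntry x , dropLast x) append∘split split∘append
      where
      append∘split : ∀ x → append (lastEntry x) (dropLast x) ≡ x
      append∘split x = Perm-ext λ y → case y
        where
        case : ∀ y → word (append (lastEntry x) (dropLast x)) y ≡ word x y
        case y with view y
        ... | ‵inject₁ i = trans (word-append-inject₁ _ _ i) (punchIn-dropLast x i)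
        ... | ‵fromℕ     = word-append-fromℕ _ _
      split∘append : ∀ z → (lastEntry (append (proj₁ z) (proj₂ z)) , dropLast (append (proj₁ z) (proj₂ z))) ≡ z
      split∘append (v , α) = cong₂ _,_ (word-append-fromℕ v α) (Perm-ext λ i →
        FinP.punchIn-injective v _ _ (trans (cong (λ u → punchIn u (word (dropLast (append v α)) i)) (sym (word-append-fromℕ v α)))
          (trans (punchIn-dropLast (append v α) i) (word-append-inject₁ v α i))))

    α⊑prefix : ∀ v α → word α ⊑ word (append v α) ∘ inject₁
    α⊑prefix v α = ⊑-trans (⊑-∘ (word α) (punchIn-increasing v)) (≗⇒⊑ (sym ∘ word-append-inject₁ v α))

    module _ {k} (R : POP k) (v : Fin (suc j)) (α : Perm j) where
      open Prefix R (word (append v α)) inject₁ toℕ-inject₁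

      avoidsBefore-append⁺ : ¬ OccursIn R (word α) → ¬ OccursBefore R (word (append v α)) j
      avoidsBefore-append⁺ ¬oα ob = ¬oα (occursIn-⊑ R (⊑-reverse (word-injective α) (α⊑prefix v α))
        (occursBefore⇒occursIn R {w = word (append v α) ∘ inject₁} (occursBefore-prefix⁻ ≤-refl ob)))

      avoidsBefore-append⁻ : ¬ OccursBefore R (word (append v α)) j → ¬ OccursIn R (word α)
      avoidsBefore-append⁻ ¬ob oα = ¬ob (occursBefore-prefix⁺
        (occursIn⇒occursBefore R {w = word (append v α) ∘ inject₁} (occursIn-⊑ R (α⊑prefix v α) oα)))

  module Containment {k} (R : POP k) (A : ℕ → ℕ) (counts : Counts R A) where
    open Decide R A counts

    AvoidersBefore : ℕ → Set
    AvoidersBefore j = [ x ∈ Perm (suc j) ∣ ¬ OccursBefore R (word x) j ]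

    card-AvoidersBefore : ∀ j → Card (AvoidersBefore j) (suc j * A j)
    card-AvoidersBefore j = ↔-trans (card-× (↔-refl {A = Fin (suc j)}) (↔-trans (counts j) (AvoidersOf↔Av R j)))
      (↔-trans (↔-sym (refine-×ʳ (λ α → ¬ OccursIn R (word α))))
      (↔-trans (refine-cong (λ (v , α) → avoidsBefore-append⁺ R v α) (λ (v , α) → avoidsBefore-append⁻ R v α))
               (refine-↔ append↔ (λ x → ¬ OccursBefore R (word x) j))))

    MinimalContainer : ∀ j → Perm (suc j) → Set
    MinimalContainer j x = ¬ OccursBefore R (word x) j × ¬ ¬ OccursIn R (word x)

    minimalContainers : ∀ j → Σ ℕ λ c →
      Card [ x ∈ Perm (suc j) ∣ MinimalContainer j x ] c × A (suc j) + c ≡ suc j * A j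
    minimalContainers j =
      proj₁ containers , ↔-trans (proj₂ containers) (refine-× _ _) ,
      card-refine-complement Avoiding (avoids? ∘ value) (card-AvoidersBefore j) card-avoiders (proj₂ containers)
      where
      Avoiding : AvoidersBefore j → Set
      Avoiding y = ¬ OccursIn R (word (value y))
      containers : Σ ℕ (Card [ y ∈ AvoidersBefore j ∣ ¬ Avoiding y ])
      containers = card-refine (card-AvoidersBefore j) (¬_ ∘ Avoiding) (¬? ∘ avoids? ∘ value)
      card-avoiders : Card [ y ∈ AvoidersBefore j ∣ Avoiding y ] (A (suc j))
      card-avoiders = ↔-trans (counts (suc j)) (↔-trans (AvoidersOf↔Av R (suc j))
        (↔-trans (refine-cong (λ x ¬o → (¬o ∘ occursBefore⇒occursIn R {w = word x}) , ¬o) (λ x → proj₂)) (↔-sym (refine-× _ _))))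


-- The chosen set holds the values of the first j entries, which appear in the relative order of
-- the first permutation.
module Shuffle (j k : ℕ) where

  open Cardinality
  open BoolVectors
  open OrderPatterns
  open Permutations
  open FinSplit
  open import Data.Nat using (_+_; _≤_; _<_)
  open import Data.Nat.Properties as ℕP using ()
  open import Data.Fin as Fin using (toℕ; fromℕ<; _↑ˡ_; _↑ʳ_; splitAt; cast)
  open import Data.Fin.Properties as FinP using (toℕ-cast; toℕ-fromℕ<; toℕ-injective)
  open import Data.Bool using (Bool; true; false; not)
  open import Data.Bool.Properties using (not-involutive; not-¬)
  open import Data.Vec using (Vec; lookup; map)
  open import Data.Vec.Properties using (lookup-map)
  open import Data.Sum using ([_,_]′)
  open import Data.Product using (_×_; _,_; proj₁; proj₂)
  open import Data.Empty using (⊥-elim)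
  open import Data.Refinement using (_,_; value-injective)
  open import Data.Irrelevant using ([_])
  open import Function using (_∘_)
  open import Function.Bundles using (_↔_; mk↔ₛ′)
  open import Relation.Binary.PropositionalEquality

  n : ℕ
  n = j + k

  private
    selectIn : (s : Vec Bool n) {t : ℕ} → .(trues s ≡ t) → Fin t → Fin n
    selectIn s e r = select s (cast (sym e) r)

    selectIn-increasing : ∀ (s : Vec Bool n) {t} .(e : trues s ≡ t) → Increasing (selectIn s e)
    selectIn-increasing s e r r′ r<r′ = select-< s _ _ (subst₂ _<_ (sym (toℕ-cast _ r)) (sym (toℕ-cast _ r′)) r<r′)

    trues-not-≡ : ∀ (s : Vec Bool n) → trues s ≡ j → trues (map not s) ≡ k
    trues-not-≡ s e = ℕP.+-cancelˡ-≡ j _ _ (trans (cong (_+ trues (map not s)) (sym e)) (trues-not s))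

    left≢right : ∀ (a : Fin j) (b : Fin k) → a ↑ˡ k ≢ j ↑ʳ b
    left≢right a b eq = ℕP.<⇒≱ (FinP.toℕ<n a)
      (subst (j ≤_) (trans (sym (FinP.toℕ-↑ʳ j b)) (trans (cong toℕ (sym eq)) (FinP.toℕ-↑ˡ a k))) (ℕP.m≤m+n j _))

  module Interleave (s : Vec Bool n) .(e : trues s ≡ j) (α : Perm j) (β : Perm k) where

    leftWord : Fin j → Fin n
    leftWord = selectIn s e ∘ word α

    rightWord : Fin k → Fin n
    rightWord = selectIn (map not s) (trues-not-≡ s e) ∘ word β

    left-true : ∀ i → lookup s (leftWord i) ≡ true
    left-true i = lookup-select s _

    right-false : ∀ i → lookup s (rightWord i) ≡ false
    right-false i = trans (sym (not-involutive _))
      (cong not (trans (sym (lookup-map (rightWord i) not s)) (lookup-select (map not s) _)))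

    interleaveWord : Fin n → Fin n
    interleaveWord x = [ leftWord , rightWord ]′ (splitAt j x)

    interleaveWord-left : ∀ i → interleaveWord (i ↑ˡ k) ≡ leftWord i
    interleaveWord-left i rewrite FinP.splitAt-↑ˡ j i k = refl

    interleaveWord-right : ∀ i → interleaveWord (j ↑ʳ i) ≡ rightWord i
    interleaveWord-right i rewrite FinP.splitAt-↑ʳ j k i = refl

    interleaveWord-injective : Inj interleaveWord
    interleaveWord-injective x y eq with splitView j k x | splitView j k y
    ... | left a  | left b  = cong (_↑ˡ k) (⊑-injective (word-injective α) (⊑-∘ (word α) (selectIn-increasing s e)) a b
                                (trans (sym (interleaveWord-left a)) (trans eq (interleaveWord-left b))))
    ... | left a  | right b = ⊥-elim (not-¬ (sym (trans (sym (left-true a))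
                                (trans (cong (lookup s) (trans (sym (interleaveWord-left a)) (trans eq (interleaveWord-right b)))) (right-false b)))) refl)
    ... | right a | left b  = ⊥-elim (not-¬ (sym (trans (sym (left-true b))
                                (trans (cong (lookup s) (trans (sym (interleaveWord-left b)) (trans (sym eq) (interleaveWord-right a)))) (right-false a)))) refl)
    ... | right a | right b = cong (j ↑ʳ_) (⊑-injective (word-injective β) (⊑-∘ (word β) (selectIn-increasing (map not s) (trues-not-≡ s e))) a b
                                (trans (sym (interleaveWord-right a)) (trans eq (interleaveWord-right b))))

    interleave : Perm n
    interleave = fromWord interleaveWord interleaveWord-injective

    word-interleave-left : ∀ i → word interleave (i ↑ˡ k) ≡ leftWord i
    word-interleave-left i = trans (word-fromWord interleaveWord interleaveWord-injective _) (interleaveWord-left i)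

    word-interleave-right : ∀ i → word interleave (j ↑ʳ i) ≡ rightWord i
    word-interleave-right i = trans (word-fromWord interleaveWord interleaveWord-injective _) (interleaveWord-right i)

    α⊑left : word α ⊑ word interleave ∘ (_↑ˡ k)
    α⊑left = ⊑-trans (⊑-∘ (word α) (selectIn-increasing s e)) (≗⇒⊑ (sym ∘ word-interleave-left))

    β⊑right : word β ⊑ word interleave ∘ (j ↑ʳ_)
    β⊑right = ⊑-trans (⊑-∘ (word β) (selectIn-increasing (map not s) (trues-not-≡ s e))) (≗⇒⊑ (sym ∘ word-interleave-right))

  module Deinterleave (x : Perm n) where

    leftPart : Fin j → Fin n
    leftPart = word x ∘ (_↑ˡ k)

    rightPart : Fin k → Fin n
    rightPart = word x ∘ (j ↑ʳ_)

    leftPart-injective : Inj leftPart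
    leftPart-injective a b eq = FinP.↑ˡ-injective k a b (word-injective x _ _ eq)

    rightPart-injective : Inj rightPart
    rightPart-injective a b eq = FinP.↑ʳ-injective j a b (word-injective x _ _ eq)

    chosen : Vec Bool n
    chosen = image leftPart

    trues-chosen : trues chosen ≡ j
    trues-chosen = trues-image leftPart leftPart-injective

    right-unchosen : ∀ i → lookup (map not chosen) (rightPart i) ≡ true
    right-unchosen i = trans (lookup-map (rightPart i) not chosen)
      (cong not (image-∌ leftPart (rightPart i) λ i′ eq → left≢right i′ i (word-injective x _ _ eq)))

    module L = Ranks chosen leftPart (image-∋ leftPart) trues-chosen
    module R = Ranks (map not chosen) rightPart right-unchosen (trues-not-≡ chosen trues-chosen)

    leftPerm : Perm j
    leftPerm = fromWord L.ranks (⊑-injective leftPart-injective L.w⊑ranks)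

    rightPerm : Perm k
    rightPerm = fromWord R.ranks (⊑-injective rightPart-injective R.w⊑ranks)

    toℕ-leftPerm : ∀ i → toℕ (word leftPerm i) ≡ rank chosen (leftPart i)
    toℕ-leftPerm i = trans (cong toℕ (word-fromWord L.ranks (⊑-injective leftPart-injective L.w⊑ranks) i)) (L.toℕ-ranks i)

    toℕ-rightPerm : ∀ i → toℕ (word rightPerm i) ≡ rank (map not chosen) (rightPart i)
    toℕ-rightPerm i = trans (cong toℕ (word-fromWord R.ranks (⊑-injective rightPart-injective R.w⊑ranks) i)) (R.toℕ-ranks i)

  deinterleave : Perm n → Choose n j × Perm j × Perm k
  deinterleave x = (chosen , [ trues-chosen ]) , leftPerm , rightPerm
    where open Deinterleave x

  interleave : Choose n j × Perm j × Perm k → Perm n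
  interleave ((s , [ e ]) , α , β) = Interleave.interleave s e α β

  interleave∘deinterleave : ∀ x → interleave (deinterleave x) ≡ x
  interleave∘deinterleave x = Perm-ext λ y → entry y
    where
    open Deinterleave x
    open Interleave chosen trues-chosen leftPerm rightPerm
    entry : ∀ y → word (Interleave.interleave chosen trues-chosen leftPerm rightPerm) y ≡ word x y
    entry y with splitView j k y
    ... | left i  = trans (word-interleave-left i) (select-rank chosen (leftPart i) _ (image-∋ leftPart i)
                      (trans (toℕ-cast _ (word leftPerm i)) (toℕ-leftPerm i)))
    ... | right i = trans (word-interleave-right i) (select-rank (map not chosen) (rightPart i) _ (right-unchosen i)
                      (trans (toℕ-cast _ (word rightPerm i)) (toℕ-rightPerm i)))

  module _ (s : Vec Bool n) .(e : trues s ≡ j) (α : Perm j) (β : Perm k) where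
    private
      open Interleave s e α β
      module D = Deinterleave (Interleave.interleave s e α β)

    chosen-interleave-lookup : ∀ v → lookup D.chosen v ≡ lookup s v
    chosen-interleave-lookup v with lookup s v in sv
    ... | true = subst (λ u → lookup D.chosen u ≡ true) leftPart-i (image-∋ D.leftPart i)
      where
      r : Fin (trues s)
      r = fromℕ< (rank<trues s v sv)
      i : Fin j
      i = proj₁ (injective⇒surjective (word α) (word-injective α) (cast e r))
      leftPart-i : D.leftPart i ≡ v
      leftPart-i = trans (word-interleave-left i) (select-rank s v _ sv (trans (toℕ-cast _ (word α i))
        (trans (cong toℕ (proj₂ (injective⇒surjective (word α) (word-injective α) (cast e r))))
          (trans (toℕ-cast _ r) (toℕ-fromℕ< _)))))
    ... | false with lookup D.chosen v in cv
    ...   | false = refl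
    ...   | true  = ⊥-elim (not-¬ (trans (sym (left-true i))
                      (trans (cong (lookup s) (trans (sym (word-interleave-left i)) leftPart-i)) sv)) refl)
      where
      i = proj₁ (image-preimage D.leftPart v cv)
      leftPart-i = proj₂ (image-preimage D.leftPart v cv)

    chosen-interleave : D.chosen ≡ s
    chosen-interleave = Vec-ext chosen-interleave-lookup

    leftPerm-interleave : ∀ i → word D.leftPerm i ≡ word α i
    leftPerm-interleave i = toℕ-injective (begin
      toℕ (word D.leftPerm i)                      ≡⟨ D.toℕ-leftPerm i ⟩
      rank D.chosen (D.leftPart i)                 ≡⟨ cong₂ rank chosen-interleave (word-interleave-left i) ⟩
      rank s (select s (cast (sym e) (word α i)))  ≡⟨ rank-select s _ ⟩
      toℕ (cast (sym e) (word α i))                      ≡⟨ toℕ-cast _ (word α i) ⟩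
      toℕ (word α i)                               ∎)
      where open ≡-Reasoning

    rightPerm-interleave : ∀ i → word D.rightPerm i ≡ word β i
    rightPerm-interleave i = toℕ-injective (begin
      toℕ (word D.rightPerm i)                            ≡⟨ D.toℕ-rightPerm i ⟩
      rank (map not D.chosen) (D.rightPart i)             ≡⟨ cong₂ rank (cong (map not) chosen-interleave) (word-interleave-right i) ⟩
      rank (map not s) (rightWord i)                      ≡⟨ rank-select (map not s) _ ⟩
      toℕ (cast (sym (trues-not-≡ s e)) (word β i))                             ≡⟨ toℕ-cast _ (word β i) ⟩
      toℕ (word β i)                                      ∎)
      where open ≡-Reasoning

  deinterleave∘interleave : ∀ z → deinterleave (interleave z) ≡ z
  deinterleave∘interleave ((s , [ e ]) , α , β) = cong₂ _,_ (value-injective (chosen-interleave s e α β))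
    (cong₂ _,_ (Perm-ext (leftPerm-interleave s e α β)) (Perm-ext (rightPerm-interleave s e α β)))

  interleave↔ : (Choose n j × Perm j × Perm k) ↔ Perm n
  interleave↔ = mk↔ₛ′ interleave deinterleave interleave∘deinterleave deinterleave∘interleave


module ShortestPrefix {k} (R : POP k) (k≥1 : 1 ≤ k) (A : ℕ → ℕ) (counts : Counts R A) where

  open Cardinality
  open Occurrences
  open Permutations
  open Decide R A counts
  open import Data.Nat using (zero; pred; _≤_; _<_)
  open import Data.Nat.Properties as ℕP using ()
  open import Data.Fin as Fin using (toℕ; fromℕ; fromℕ<; _≟_)
  open import Data.Fin.Properties using (toℕ<n; toℕ-fromℕ; toℕ-fromℕ<; toℕ-inject; toℕ-injective; ¬∀⟶∃¬-smallest)
  open import Data.Product using (Σ; _×_; _,_; proj₁; proj₂)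
  open import Data.Empty using (⊥-elim; ⊥-elim-irr)
  open import Data.Refinement using (Refinement-syntax)
  open import Data.Irrelevant using ([_])
  open import Function using (_∘_)
  open import Function.Bundles using (_↔_)
  open import Relation.Binary.PropositionalEquality
  open import Relation.Nullary using (¬_)
  open import Relation.Nullary.Decidable using (recompute)

  ShortestPrefix : ∀ {n} → ℕ → Perm n → Set
  ShortestPrefix t x = ¬ ¬ OccursBefore R (word x) t × ¬ OccursBefore R (word x) (pred t)

  module _ {n} (x : Perm n) .(contains : ¬ ¬ OccursIn R (word x)) where

    private
      bounded : (t : Fin (suc n)) → toℕ t ≤ n
      bounded t = ℕP.≤-pred (toℕ<n t)

      smallest = ¬∀⟶∃¬-smallest (suc n) _ (λ t → avoidsBefore? x (toℕ t) (bounded t)) λ avoids →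
        ⊥-elim-irr (contains λ o → avoids (fromℕ n)
          (subst (OccursBefore R (word x)) (sym (toℕ-fromℕ n)) (occursIn⇒occursBefore R {w = word x} o)))

    shortest : Fin (suc n)
    shortest = proj₁ smallest

    contains-shortest : ¬ ¬ OccursBefore R (word x) (toℕ shortest)
    contains-shortest = proj₁ (proj₂ smallest)

    avoids-below-shortest : ∀ t → t < toℕ shortest → ¬ OccursBefore R (word x) t
    avoids-below-shortest t t< = subst (λ u → ¬ OccursBefore R (word x) u)
      (trans (toℕ-inject (fromℕ< t<)) (toℕ-fromℕ< t<)) (proj₂ (proj₂ smallest) (fromℕ< t<))

    shortestPrefix : ShortestPrefix (toℕ shortest) x
    shortestPrefix = contains-shortest , avoids-pred shortest refl
      where
      avoids-pred : ∀ t → t ≡ shortest → ¬ OccursBefore R (word x) (pred (toℕ t))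
      avoids-pred Fin.zero    eq = ⊥-elim (contains-shortest (subst (λ u → ¬ OccursBefore R (word x) (toℕ u)) eq
                                     (¬occursBefore-zero R {w = word x} k≥1)))
      avoids-pred (Fin.suc t) eq = avoids-below-shortest (toℕ t) (subst (λ u → toℕ t < toℕ u) eq (ℕP.n<1+n (toℕ t)))

    shortestPrefix-unique : ∀ t → ShortestPrefix (toℕ t) x → shortest ≡ t
    shortestPrefix-unique t (contains-t , avoids-pred-t) = toℕ-injective (ℕP.≤-antisym
      (ℕP.≮⇒≥ λ t< → contains-t (avoids-below-shortest (toℕ t) t<))
      (ℕP.≮⇒≥ λ <t → contains-shortest λ ob → avoids-pred-t (occursBefore-mono R {w = word x} (ℕP.<⇒≤pred <t) ob)))

  Σ-shortestPrefix-↔ : ∀ {n} (Q : Perm n → Set) →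
    [ x ∈ Perm n ∣ Q x × ¬ ¬ OccursIn R (word x) ] ↔ Σ (Fin (suc n)) λ t → [ x ∈ Perm n ∣ Q x × ShortestPrefix (toℕ t) x ]
  Σ-shortestPrefix-↔ Q = Σ-fibres-↔ _ _
    (λ x q → shortest x (proj₂ q))
    (λ x q → [ proj₁ q , shortestPrefix x (proj₂ q) ])
    (λ t x q p → recompute (shortest x (proj₂ q) ≟ t) (shortestPrefix-unique x (proj₂ q) t (proj₂ p)))
    (λ t x p → proj₁ p , λ ¬o → proj₁ (proj₂ p) (¬o ∘ occursBefore⇒occursIn R {w = word x}))


-- count n counts the avoiders of p as sorted in FirstChainDecomposition: A n of them avoid σ and
-- splitCount n t have a shortest prefix of length t containing σ.
module SplitCount (A M a′ : ℕ → ℕ) where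

  open EGFAlgebra
  open import Data.Nat as ℕ using (zero; _∸_)
  open import Data.Nat.Properties as ℕP using (+-0-monoid)
  open import Algebra.Properties.Monoid.Sum +-0-monoid using (sum)
  open import Data.Nat.Combinatorics using (_C_)
  open import Data.Integer using (+_; 0ℤ; _+_; _*_; _-_)
  open import Data.Integer.Properties as ℤP using ()
  open import Data.Integer.Solver using (module +-*-Solver)
  open import Data.Fin using (toℕ)
  open import Function using (_∘_)
  open import Relation.Binary.PropositionalEquality
  open +-*-Solver using (solve; _:+_; _:-_; _:=_)
  open ≡-Reasoning

  splitCount : ℕ → ℕ → ℕ
  splitCount n zero    = 0
  splitCount n (suc j) = (n C suc j) ℕ.* (M j ℕ.* a′ (n ∸ suc j))

  count : ℕ → ℕ
  count n = A n ℕ.+ sum {suc n} (splitCount n ∘ toℕ)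

  sum-sumTo : ∀ n (g : ℕ → ℕ) → + sum {suc n} (g ∘ toℕ) ≡ sumTo n (+_ ∘ g)
  sum-sumTo zero    g = cong +_ (ℕP.+-identityʳ (g 0))
  sum-sumTo (suc n) g = begin
    + (g 0 ℕ.+ sum {suc n} (g ∘ suc ∘ toℕ))   ≡⟨ ℤP.pos-+ (g 0) _ ⟩
    + g 0 + + sum {suc n} (g ∘ suc ∘ toℕ)     ≡⟨ cong (_+_ (+ g 0)) (sum-sumTo n (g ∘ suc)) ⟩
    + g 0 + sumTo n (+_ ∘ g ∘ suc)            ≡⟨ sumTo-suc n (+_ ∘ g) ⟨
    sumTo (suc n) (+_ ∘ g)                    ∎

  module _ (A0≡1 : A 0 ≡ 1) (A+M : ∀ j → A (suc j) ℕ.+ M j ≡ suc j ℕ.* A j) where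

    -- The coefficients of (x − 1) A(x) + 1 are 1 − A 0 = 0 and (j+1) A j − A (j+1) = M j.
    M≡factorE : ∀ j → + M j ≡ factorE (egf A) (suc j)
    M≡factorE j = begin
      + M j                                     ≡⟨ solve 2 (λ a m → m := (a :+ m) :- a :+ con 0ℤ) refl (+ A (suc j)) (+ M j) ⟩
      + A (suc j) + + M j - + A (suc j) + 0ℤ   ≡⟨ cong (λ z → z - + A (suc j) + 0ℤ) (ℤP.pos-+ (A (suc j)) (M j)) ⟨
      + (A (suc j) ℕ.+ M j) - + A (suc j) + 0ℤ ≡⟨ cong (λ z → + z - + A (suc j) + 0ℤ) (A+M j) ⟩
      + (suc j ℕ.* A j) - + A (suc j) + 0ℤ     ≡⟨ cong (λ z → z - + A (suc j) + 0ℤ) (ℤP.pos-* (suc j) (A j)) ⟩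
      factorE (egf A) (suc j)                   ∎
      where open +-*-Solver using (con)

    splitCount≡ : ∀ n j → + splitCount n j ≡ + (n C j) * factorE (egf A) j * + a′ (n ∸ j)
    splitCount≡ n zero    rewrite A0≡1 =
      sym (trans (cong (_* + a′ n) (ℤP.*-zeroʳ (+ (n C 0)))) (ℤP.*-zeroˡ (+ a′ n)))
    splitCount≡ n (suc j) = begin
      + ((n C suc j) ℕ.* (M j ℕ.* a′ (n ∸ suc j)))     ≡⟨ ℤP.pos-* (n C suc j) _ ⟩
      + (n C suc j) * + (M j ℕ.* a′ (n ∸ suc j))       ≡⟨ cong (_*_ (+ (n C suc j))) (ℤP.pos-* (M j) _) ⟩
      + (n C suc j) * (+ M j * + a′ (n ∸ suc j))       ≡⟨ ℤP.*-assoc (+ (n C suc j)) _ _ ⟨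
      + (n C suc j) * + M j * + a′ (n ∸ suc j)         ≡⟨ cong (λ z → + (n C suc j) * z * + a′ (n ∸ suc j)) (M≡factorE j) ⟩
      + (n C suc j) * factorE (egf A) (suc j) * + a′ (n ∸ suc j) ∎

    egf-count : egf count ≗E egf A +E (factorE (egf A) *E egf a′)
    egf-count n = begin
      + (A n ℕ.+ sum {suc n} (splitCount n ∘ toℕ))   ≡⟨ ℤP.pos-+ (A n) _ ⟩
      + A n + + sum {suc n} (splitCount n ∘ toℕ)     ≡⟨ cong (_+_ (+ A n)) (sum-sumTo n (splitCount n)) ⟩
      + A n + sumTo n (+_ ∘ splitCount n)            ≡⟨ cong (_+_ (+ A n)) (sumTo-cong n (λ j _ → splitCount≡ n j)) ⟩
      + A n + (factorE (egf A) *E egf a′) n          ∎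


module FirstChainDecomposition (m : ℕ) (τ : Fin (suc m) → List ℕ) (τ-perm : ∀ i → IsChainPerm (τ i))
  (A : ℕ → ℕ) (counts-σ : Counts (ChainPattern (τ Fin.zero)) A)
  (a′ : ℕ → ℕ) (counts-ρ : Counts (DisjointChains m (λ i → τ (Fin.suc i))) a′) where

  open import Data.Nat using (zero; _+_; _*_; _∸_)
  open import Data.Nat.Properties as ℕP using (+-0-monoid)
  open import Algebra.Properties.Monoid.Sum +-0-monoid using (sum)
  open import Data.Nat.Combinatorics using (_C_)
  open import Data.Fin as Fin using (toℕ; _↑ˡ_; _↑ʳ_)
  open import Data.Fin.Properties using (toℕ-↑ˡ; toℕ<n)
  open import Data.Product using (Σ; _×_; _,_; proj₁; proj₂)
  open import Data.Product.Function.NonDependent.Propositional using (_×-↔_)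
  open import Data.Sum using (_⊎_)
  open import Data.Sum.Function.Propositional using (_⊎-↔_)
  open import Data.Empty using (⊥-elim-irr)
  open import Data.Refinement using (Refinement-syntax; _,_; value)
  open import Data.Irrelevant using ([_])
  open import Function using (_∘_)
  open import Function.Bundles using (_↔_)
  open import Function.Properties.Inverse using (↔-refl; ↔-sym; ↔-trans)
  open import Relation.Binary.PropositionalEquality
  open import Relation.Nullary using (¬_)
  open import Data.Bool using (Bool)
  open import Data.Vec using (Vec)

  open ChainSplit m τ τ-perm
  open Cardinality
  open BoolVectors using (trues; card-Choose)
  open OrderPatterns
  open Occurrences
  open Permutations
  open LastEntry.Containment σ A counts-σ
  open ShortestPrefix σ (proj₁ (τ-perm Fin.zero)) A counts-σ
  open Decide σ A counts-σ

  M : ℕ → ℕ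
  M j = proj₁ (minimalContainers j)

  open SplitCount A M a′ public using (splitCount; count)
  open EGFAlgebra using (_≗E_)

  card-MinimalContainer : ∀ j → Card [ x ∈ Perm (suc j) ∣ MinimalContainer j x ] (M j)
  card-MinimalContainer j = proj₁ (proj₂ (minimalContainers j))

  A+M : ∀ j → A (suc j) + M j ≡ suc j * A j
  A+M j = proj₂ (proj₂ (minimalContainers j))

  AvoiderWithPrefix : ∀ {n} → ℕ → Perm n → Set
  AvoiderWithPrefix t x = ¬ OccursIn p (word x) × ShortestPrefix t x

  module _ (j r : ℕ) (s : Vec Bool (suc j + r)) .(e : trues s ≡ suc j) (α : Perm (suc j)) (β : Perm r) where
    private
      open Shuffle (suc j) r using (module Interleave)
      open Interleave s e α β
      open Prefix σ (word interleave) (_↑ˡ r) (λ i → toℕ-↑ˡ i r)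
      left⊑α : word interleave ∘ (_↑ˡ r) ⊑ word α
      left⊑α = ⊑-reverse (word-injective α) α⊑left
      right⊑β : word interleave ∘ (suc j ↑ʳ_) ⊑ word β
      right⊑β = ⊑-reverse (word-injective β) β⊑right

    avoiderWithPrefix-interleave⁺ : AvoiderWithPrefix (suc j) interleave → MinimalContainer j α × ¬ OccursIn ρ (word β)
    avoiderWithPrefix-interleave⁺ (¬p , contains , ¬before) =
      ((λ ob → ¬before (occursBefore-prefix⁺ (occursBefore-⊑ σ α⊑left ob))) ,
       (λ ¬oα → contains λ ob → ¬oα (occursIn-⊑ σ left⊑α
         (occursBefore⇒occursIn σ {w = word interleave ∘ (_↑ˡ r)} (occursBefore-prefix⁻ ℕP.≤-refl ob))))) ,
      (λ oβ → contains λ ob → ¬p (occursIn-join (word interleave) ob (occursIn-⊑ ρ β⊑right oβ)))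

    avoiderWithPrefix-interleave⁻ : MinimalContainer j α × ¬ OccursIn ρ (word β) → AvoiderWithPrefix (suc j) interleave
    avoiderWithPrefix-interleave⁻ ((¬before , contains) , ¬oβ) =
      (λ op → ¬oβ (occursIn-⊑ ρ right⊑β (occursIn-rest (word interleave) ¬before′ op))) ,
      (λ ¬ob → contains λ oα → ¬ob (occursBefore-prefix⁺
        (occursIn⇒occursBefore σ {w = word interleave ∘ (_↑ˡ r)} (occursIn-⊑ σ α⊑left oα)))) ,
      ¬before′
      where
      ¬before′ : ¬ OccursBefore σ (word interleave) j
      ¬before′ ob = ¬before (occursBefore-⊑ σ left⊑α (occursBefore-prefix⁻ (ℕP.n≤1+n j) ob))

  card-AvoiderWithPrefix-suc : ∀ j r → Card [ x ∈ Perm (suc j + r) ∣ AvoiderWithPrefix (suc j) x ] (((suc j + r) C suc j) * (M j * a′ r))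
  card-AvoiderWithPrefix-suc j r =
    ↔-trans (card-× (card-Choose (suc j + r) (suc j))
                    (card-× (card-MinimalContainer j) (↔-trans (counts-ρ r) (AvoidersOf↔Av ρ r))))
    (↔-trans (↔-sym (↔-trans (refine-×ʳ _) (↔-refl ×-↔ refine-⊗ (MinimalContainer j) (λ β → ¬ OccursIn ρ (word β)))))
    (↔-trans (refine-cong (λ { ((s , [ e ]) , α , β) → avoiderWithPrefix-interleave⁻ j r s e α β })
                          (λ { ((s , [ e ]) , α , β) → avoiderWithPrefix-interleave⁺ j r s e α β }))
             (refine-↔ (Shuffle.interleave↔ (suc j) r) (AvoiderWithPrefix (suc j)))))

  card-AvoiderWithPrefix : ∀ n t → t ≤ n → Card [ x ∈ Perm n ∣ AvoiderWithPrefix t x ] (splitCount n t)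
  card-AvoiderWithPrefix n zero    _   = card-empty λ { (x , [ split ]) →
    ⊥-elim-irr (proj₁ (proj₂ split) (¬occursBefore-zero σ {w = word x} (proj₁ (τ-perm Fin.zero)))) }
  card-AvoiderWithPrefix n (suc j) j<n = subst (λ N → Card [ x ∈ Perm N ∣ AvoiderWithPrefix (suc j) x ] ((N C suc j) * (M j * a′ (n ∸ suc j))))
    (ℕP.m+[n∸m]≡n j<n) (card-AvoiderWithPrefix-suc j (n ∸ suc j))

  counts-p : Counts p count
  counts-p n = ↔-trans (card-⊎ card-avoiding-σ card-containing-σ) (↔-sym sorted)
    where
    Avoiding-p : Perm n → Set
    Avoiding-p x = ¬ OccursIn p (word x)

    card-avoiding-σ : Card [ x ∈ Perm n ∣ Avoiding-p x × ¬ OccursIn σ (word x) ] (A n)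
    card-avoiding-σ = ↔-trans (counts-σ n) (↔-trans (AvoidersOf↔Av σ n)
      (refine-cong (λ x ¬oσ → ¬oσ ∘ occursIn-first {w = word x} , ¬oσ) (λ x → proj₂)))

    card-containing-σ : Card (Σ (Fin (suc n)) λ t → [ x ∈ Perm n ∣ AvoiderWithPrefix (toℕ t) x ]) (sum {suc n} (splitCount n ∘ toℕ))
    card-containing-σ = card-Σ (suc n) _ _ λ t → card-AvoiderWithPrefix n (toℕ t) (ℕP.≤-pred (toℕ<n t))

    sorted : AvoidersOf p n ↔ ([ x ∈ Perm n ∣ Avoiding-p x × ¬ OccursIn σ (word x) ] ⊎
                               Σ (Fin (suc n)) λ t → [ x ∈ Perm n ∣ AvoiderWithPrefix (toℕ t) x ])
    sorted = ↔-trans (AvoidersOf↔Av p n) (↔-trans (refine-⊎ _ (avoids? ∘ value))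
      (refine-× _ _ ⊎-↔ ↔-trans (refine-× _ _) (Σ-shortestPrefix-↔ Avoiding-p)))

  egf-count : egf count ≗E egf A +E (factorE (egf A) *E egf a′)
  egf-count = SplitCount.egf-count A M a′ (count-zero σ (proj₁ (τ-perm Fin.zero)) counts-σ) A+M


open EGFAlgebra using (_≗E_; *E-cong; chainFormula-suc)
open Cardinality using (card-unique)

disjointChains-egf : ∀ m (τ : Fin m → List ℕ) → (∀ i → IsChainPerm (τ i)) →
  (as : Fin m → ℕ → ℕ) → (∀ i → Counts (ChainPattern (τ i)) (as i)) →
  Σ (ℕ → ℕ) λ a → Counts (DisjointChains m τ) a × egf a ≗E chainFormula m (λ i → egf (as i))
disjointChains-egf zero    τ _ _ _ = (λ _ → 0) , Permutations.counts-POP₀ (DisjointChains zero τ) , λ _ → refl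
disjointChains-egf (suc m) τ τ-perm as counts
  with disjointChains-egf m (τ ∘ Fin.suc) (τ-perm ∘ Fin.suc) (as ∘ Fin.suc) (counts ∘ Fin.suc)
... | a′ , counts-a′ , egf-a′ = count , counts-p , λ n → begin
  egf count n                                                         ≡⟨ egf-count n ⟩
  (egf A +E (factorE (egf A) *E egf a′)) n                            ≡⟨ cong (ℤ._+_ (egf A n)) (*E-cong {factorE (egf A)} (λ _ → refl) egf-a′ n) ⟩
  (egf A +E (factorE (egf A) *E chainFormula m (egf ∘ as ∘ Fin.suc))) n ≡⟨ chainFormula-suc m (egf ∘ as) n ⟨
  chainFormula (suc m) (egf ∘ as) n                                   ∎
  where
  A = as Fin.zero
  open FirstChainDecomposition m τ τ-perm A (counts Fin.zero) a′ counts-a′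
  open ≡-Reasoning

theorem19 : (m : ℕ) (τ : Fin m → List ℕ) → (∀ i → IsChainPerm (τ i)) →
    (a : ℕ → ℕ) (as : Fin m → ℕ → ℕ) →
    Counts (DisjointChains m τ) a →
    (∀ i → Counts (ChainPattern (τ i)) (as i)) →
    ∀ n → egf a n ≡ chainFormula m (λ i → egf (as i)) n
theorem19 m τ τ-perm a as counts-a counts n with disjointChains-egf m τ τ-perm as counts
... | a* , counts-a* , egf-a* = trans (cong ℤ.+_ (card-unique (counts-a n) (counts-a* n))) (egf-a* n)
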